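{- With $G(x,y)=\sum_{T}\frac{x^{|\mathrm{LV}(T)|}\,y^{|\mathrm{RV}(T)|}}{|\mathrm{LV}(T)|!\,|\mathrm{RV}(T)|!}$ and $H(x,y)=\sum_{T}\frac{x^{|\mathrm{LV}(T)|+1}\,y^{|\mathrm{RV}(T)|+1}}{(|\mathrm{LV}(T)|+1)!\,(|\mathrm{RV}(T)|+1)!}$, both sums running over all non-empty non-ambiguous trees $T$, one has $$G=\frac{e^{x+y}}{\big(1-(e^x-1)(e^y-1)\big)^2}\qquad\text{and}\qquad H=-\log\big(1-(e^x-1)(e^y-1)\big).$$
   Context: A binary tree is a rooted tree in which each vertex has either no child, a left child, a right child, or both. For a binary tree $B$, $\mathrm{LV}(B)$ (resp. $\mathrm{RV}(B)$) denotes the set of vertices that are left children (resp. right children); the root belongs to neither. A non-ambiguous tree (NAT) is a non-empty binary tree $B$ together with a labelling of its left children by $1,\dots,|\mathrm{LV}(B)|$ (each label used exactly once) and of its right children by $1,\dots,|\mathrm{RV}(B)|$ (each label used exactly once), such that whenever $U$ and $V$ are both left children (resp. both right children) and $U$ is a proper ancestor of $V$, the label of $U$ is strictly greater than the label of $V$. -}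

module Defs where

open import Data.Bool using (Bool; true; false; _∧_; T)
open import Data.Nat as ℕ using (ℕ; zero; suc; _∸_; _!; _<ᵇ_; _≡ᵇ_)
open import Data.Nat.Properties using (_!*_!≢0; _!≢0)
open import Data.Integer using (+_)
open import Data.Rational using (ℚ; 0ℚ; 1ℚ; _+_; _*_; _-_; _/_)
open import Data.List using (List; []; _∷_; _++_; length; upTo)
open import Data.Maybe using (Maybe; just; nothing)
open import Data.Product using (Σ; _×_; _,_)

-- A vertex is 'node l r' where l (resp. r) is 'nothing' if there is no
-- left (resp. right) child, and 'just (ℓ , t)' if there is a left
-- (resp. right) child carrying label ℓ and whose subtree is t.
-- The root carries no label (it is neither a left nor a right child).

data LTree : Set where
  node : Maybe (ℕ × LTree) → Maybe (ℕ × LTree) → LTree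

allᵇ : {A : Set} → (A → Bool) → List A → Bool
allᵇ p [] = true
allᵇ p (x ∷ xs) = p x ∧ allᵇ p xs

leftLabels : LTree → List ℕ
leftLabelsM : Maybe (ℕ × LTree) → List ℕ
leftLabelsR : Maybe (ℕ × LTree) → List ℕ
leftLabels (node l r) = leftLabelsM l ++ leftLabelsR r
leftLabelsM nothing = []
leftLabelsM (just (ℓ , t)) = ℓ ∷ leftLabels t
leftLabelsR nothing = []
leftLabelsR (just (_ , t)) = leftLabels t

rightLabels : LTree → List ℕ
rightLabelsL : Maybe (ℕ × LTree) → List ℕ
rightLabelsM : Maybe (ℕ × LTree) → List ℕ
rightLabels (node l r) = rightLabelsL l ++ rightLabelsM r
rightLabelsL nothing = []
rightLabelsL (just (_ , t)) = rightLabels t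
rightLabelsM nothing = []
rightLabelsM (just (ℓ , t)) = ℓ ∷ rightLabels t

leftDecr : LTree → Bool
leftDecrL : Maybe (ℕ × LTree) → Bool
leftDecrR : Maybe (ℕ × LTree) → Bool
leftDecr (node l r) = leftDecrL l ∧ leftDecrR r
leftDecrL nothing = true
leftDecrL (just (ℓ , t)) = allᵇ (λ m → m <ᵇ ℓ) (leftLabels t) ∧ leftDecr t
leftDecrR nothing = true
leftDecrR (just (_ , t)) = leftDecr t

rightDecr : LTree → Bool
rightDecrL : Maybe (ℕ × LTree) → Bool
rightDecrR : Maybe (ℕ × LTree) → Bool
rightDecr (node l r) = rightDecrL l ∧ rightDecrR r
rightDecrL nothing = true
rightDecrL (just (_ , t)) = rightDecr t
rightDecrR nothing = true
rightDecrR (just (ℓ , t)) = allᵇ (λ m → m <ᵇ ℓ) (rightLabels t) ∧ rightDecr t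

countᵇ : ℕ → List ℕ → ℕ
countᵇ i [] = 0
countᵇ i (x ∷ xs) with i ≡ᵇ x
... | true  = suc (countᵇ i xs)
... | false = countᵇ i xs

isLabelling : ℕ → List ℕ → Bool
isLabelling n xs =
  (length xs ≡ᵇ n) ∧ allᵇ (λ i → countᵇ (suc i) xs ≡ᵇ 1) (upTo n)

isNAT : ℕ → ℕ → LTree → Bool
isNAT a b t =
  isLabelling a (leftLabels t) ∧ isLabelling b (rightLabels t)
  ∧ leftDecr t ∧ rightDecr t

-- the set of NATs T with |LV(T)| = a and |RV(T)| = b
-- (the predicate is Bool-valued so membership is proof-irrelevant)
NAT : ℕ → ℕ → Set
NAT a b = Σ LTree (λ t → T (isNAT a b t))

-- Formal power series in x, y over ℚ, as coefficient functions:
-- F a b is the coefficient of x^a y^b.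

FPS : Set
FPS = ℕ → ℕ → ℚ

sumTo : ℕ → (ℕ → ℚ) → ℚ
sumTo zero f = f 0
sumTo (suc n) f = sumTo n f + f (suc n)

fromNat : ℕ → ℚ
fromNat n = + n / 1

oneF : FPS
oneF zero zero = 1ℚ
oneF _ _ = 0ℚ

_⊕_ : FPS → FPS → FPS
(f ⊕ g) a b = f a b + g a b

_⊖_ : FPS → FPS → FPS
(f ⊖ g) a b = f a b - g a b

_⊛_ : FPS → FPS → FPS
(f ⊛ g) a b = sumTo a (λ i → sumTo b (λ j → f i j * g (a ∸ i) (b ∸ j)))

_^F_ : FPS → ℕ → FPS
f ^F zero = oneF
f ^F suc k = f ⊛ (f ^F k)

expX : FPS
expX a zero = + 1 / (a !)
  where instance _ = a !≢0
expX a (suc _) = 0ℚ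

expY : FPS
expY zero b = + 1 / (b !)
  where instance _ = b !≢0
expY (suc _) b = 0ℚ

-- Substitution c(u) of a bivariate series u WITH ZERO CONSTANT TERM into a
-- univariate series c(t) = Σ_k c k t^k.  Since u^k has no monomials of
-- total degree < k, the coefficient of x^a y^b in c(u) is the finite sum
-- Σ_{k=0}^{a+b} c k · [x^a y^b] u^k.
substF : (ℕ → ℚ) → FPS → FPS
substF c u a b = sumTo (a ℕ.+ b) (λ k → c k * (u ^F k) a b)

-- 1/(1-t)^2 = Σ_k (k+1) t^k
invSqOneMinus : ℕ → ℚ
invSqOneMinus k = fromNat (suc k)

-- -log(1-t) = Σ_{k≥1} t^k / k
negLogOneMinus : ℕ → ℚ
negLogOneMinus zero = 0ℚ
negLogOneMinus (suc k) = + 1 / suc k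

P : FPS
P = (expX ⊖ oneF) ⊛ (expY ⊖ oneF)

rhsG : FPS
rhsG = (expX ⊛ expY) ⊛ substF invSqOneMinus P

rhsH : FPS
rhsH = substF negLogOneMinus P

Gser : (ℕ → ℕ → ℕ) → FPS
Gser N a b = + N a b / (a ! ℕ.* b !)
  where instance _ = a !* b !≢0

Hser : (ℕ → ℕ → ℕ) → FPS
Hser N (suc a) (suc b) = + N a b / (suc a ! ℕ.* suc b !)
  where instance _ = suc a !* suc b !≢0
Hser N _ _ = 0ℚ

module Submission where

-- Cutting a NAT at its root leaves a left and a right branch; each is empty or a NAT hanging from a
-- child whose label is the largest one on its side, and the labels of each side are shared out between
-- the two branches arbitrarily.  So the exponential generating function G of the counts is the product
-- E₁E₂ of the branch series, which satisfy ∂ₓE₁ = G, E₁(0, y) = 1 and ∂ᵧE₂ = G, E₂(x, 0) = 1; these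
-- equations determine G coefficient by coefficient, by induction on the total degree.
-- With P = (eˣ - 1)(eʸ - 1) and Q = 1/(1 - P) they are solved by E₁ = eˣQ and E₂ = eʸQ: from Q = 1 + PQ,
-- any derivation d gives dQ = Q² dP, and 1 + Q ∂ₓP = eʸQ because 1 - P + ∂ₓP = eʸ; thus G = eˣeʸQ².
-- Finally ∂ₓ(-log(1 - P)) = Q ∂ₓP and ∂ᵧ(Q ∂ₓP) = eˣeʸQ², so -log(1 - P) has the coefficients of H.

open import Defs
open import Data.Nat using (ℕ)
open import Data.Fin using (Fin)
open import Data.Product using (Σ; _×_; _,_)
open import Function.Bundles using (_↔_)
open import Relation.Binary.PropositionalEquality using (_≡_)
open import Data.Rational using (0ℚ)

module FiniteSum where

  open import Defs
  open import Data.Nat as ℕ using (ℕ; zero; suc; _∸_; _≤_; _<_; z≤n; s≤s)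
  import Data.Nat.Properties as ℕₚ
  open import Data.Rational using (ℚ; 0ℚ; _+_; _*_)
  open import Data.Rational.Properties
  open import Algebra.Bundles using (CommutativeMonoid)
  open import Algebra.Properties.CommutativeSemigroup (CommutativeMonoid.commutativeSemigroup +-0-commutativeMonoid)
    using (interchange)
  open import Data.Sum using (inj₁; inj₂)
  open import Function using (_∘_)
  open import Relation.Binary.PropositionalEquality

  sumTo-cong : ∀ n {f g : ℕ → ℚ} → (∀ i → i ≤ n → f i ≡ g i) → sumTo n f ≡ sumTo n g
  sumTo-cong zero    f≗g = f≗g 0 z≤n
  sumTo-cong (suc n) f≗g =
    cong₂ _+_ (sumTo-cong n (λ i i≤n → f≗g i (ℕₚ.m≤n⇒m≤1+n i≤n))) (f≗g (suc n) ℕₚ.≤-refl)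

  sumTo-zero : ∀ n (f : ℕ → ℚ) → (∀ i → i ≤ n → f i ≡ 0ℚ) → sumTo n f ≡ 0ℚ
  sumTo-zero n f f≗0 = trans (sumTo-cong n f≗0) (go n)
    where
    go : ∀ n → sumTo n (λ _ → 0ℚ) ≡ 0ℚ
    go zero    = refl
    go (suc n) = trans (cong (_+ 0ℚ) (go n)) (+-identityʳ 0ℚ)

  sumTo-suc : ∀ n (f : ℕ → ℚ) → sumTo (suc n) f ≡ f 0 + sumTo n (f ∘ suc)
  sumTo-suc zero    f = refl
  sumTo-suc (suc n) f =
    trans (cong (_+ f (suc (suc n))) (sumTo-suc n f)) (+-assoc (f 0) (sumTo n (f ∘ suc)) (f (suc (suc n))))

  sumTo-+ : ∀ n (f g : ℕ → ℚ) → sumTo n (λ i → f i + g i) ≡ sumTo n f + sumTo n g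
  sumTo-+ zero    f g = refl
  sumTo-+ (suc n) f g =
    trans (cong (_+ (f (suc n) + g (suc n))) (sumTo-+ n f g))
          (interchange (sumTo n f) (sumTo n g) (f (suc n)) (g (suc n)))

  *-sumToˡ : ∀ n c (f : ℕ → ℚ) → c * sumTo n f ≡ sumTo n (λ i → c * f i)
  *-sumToˡ zero    c f = refl
  *-sumToˡ (suc n) c f =
    trans (*-distribˡ-+ c (sumTo n f) (f (suc n))) (cong (_+ (c * f (suc n))) (*-sumToˡ n c f))

  *-sumToʳ : ∀ n c (f : ℕ → ℚ) → sumTo n f * c ≡ sumTo n (λ i → f i * c)
  *-sumToʳ zero    c f = refl
  *-sumToʳ (suc n) c f =
    trans (*-distribʳ-+ c (sumTo n f) (f (suc n))) (cong (_+ (f (suc n) * c)) (*-sumToʳ n c f))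

  sumTo-comm : ∀ n m (F : ℕ → ℕ → ℚ) →
               sumTo n (λ i → sumTo m (F i)) ≡ sumTo m (λ j → sumTo n (λ i → F i j))
  sumTo-comm zero    m F = refl
  sumTo-comm (suc n) m F =
    trans (cong (_+ sumTo m (F (suc n))) (sumTo-comm n m F))
          (sym (sumTo-+ m (λ j → sumTo n (λ i → F i j)) (F (suc n))))

  sumTo-reverse : ∀ n (f : ℕ → ℚ) → sumTo n f ≡ sumTo n (λ i → f (n ∸ i))
  sumTo-reverse zero    f = refl
  sumTo-reverse (suc n) f = begin
    sumTo n f + f (suc n)                    ≡⟨ cong (_+ f (suc n)) (sumTo-reverse n f) ⟩
    sumTo n (λ i → f (n ∸ i)) + f (suc n)    ≡⟨ +-comm (sumTo n (λ i → f (n ∸ i))) (f (suc n)) ⟩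
    f (suc n) + sumTo n (λ i → f (n ∸ i))    ≡⟨ sym (sumTo-suc n (λ i → f (suc n ∸ i))) ⟩
    sumTo (suc n) (λ i → f (suc n ∸ i))      ∎
    where open ≡-Reasoning

  sumTo-extend : ∀ m n (f : ℕ → ℚ) → (∀ k → m < k → f k ≡ 0ℚ) → m ≤ n → sumTo n f ≡ sumTo m f
  sumTo-extend m zero    f f≗0 z≤n = refl
  sumTo-extend m (suc n) f f≗0 m≤1+n with ℕₚ.m≤n⇒m<n∨m≡n m≤1+n
  ... | inj₂ refl      = refl
  ... | inj₁ (s≤s m≤n) =
    trans (cong₂ _+_ (sumTo-extend m n f f≗0 m≤n) (f≗0 (suc n) (s≤s m≤n))) (+-identityʳ _)

  sumTo-single : ∀ n (f : ℕ → ℚ) → (∀ k → 0 < k → f k ≡ 0ℚ) → sumTo n f ≡ f 0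
  sumTo-single n f f≗0 = sumTo-extend 0 n f f≗0 z≤n

  sumTo-triangle : ∀ a (F : ℕ → ℕ → ℚ) →
    sumTo a (λ i → sumTo i (λ i' → F i' (i ∸ i'))) ≡ sumTo a (λ i' → sumTo (a ∸ i') (F i'))
  sumTo-triangle zero    F = refl
  sumTo-triangle (suc a) F = begin
    sumTo a (λ i → sumTo i (λ i' → F i' (i ∸ i'))) + sumTo (suc a) (λ i' → F i' (suc a ∸ i'))
      ≡⟨ cong (_+ sumTo (suc a) (λ i' → F i' (suc a ∸ i'))) (sumTo-triangle a F) ⟩
    sumTo a (λ i' → sumTo (a ∸ i') (F i')) + (sumTo a (λ i' → F i' (suc a ∸ i')) + F (suc a) (a ∸ a))
      ≡⟨ sym (+-assoc (sumTo a (λ i' → sumTo (a ∸ i') (F i'))) _ _) ⟩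
    (sumTo a (λ i' → sumTo (a ∸ i') (F i')) + sumTo a (λ i' → F i' (suc a ∸ i'))) + F (suc a) (a ∸ a)
      ≡⟨ cong (_+ F (suc a) (a ∸ a)) (sym (sumTo-+ a _ _)) ⟩
    sumTo a (λ i' → sumTo (a ∸ i') (F i') + F i' (suc a ∸ i')) + F (suc a) (a ∸ a)
      ≡⟨ cong₂ _+_ (sumTo-cong a (λ i' i'≤a → extend-row (F i') i'≤a)) last-row ⟩
    sumTo a (λ i' → sumTo (suc a ∸ i') (F i')) + sumTo (suc a ∸ suc a) (F (suc a))
      ∎
    where
    open ≡-Reasoning
    extend-row : ∀ {i'} (g : ℕ → ℚ) → i' ≤ a → sumTo (a ∸ i') g + g (suc a ∸ i') ≡ sumTo (suc a ∸ i') g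
    extend-row g i'≤a rewrite ℕₚ.+-∸-assoc 1 i'≤a = refl
    last-row : F (suc a) (a ∸ a) ≡ sumTo (suc a ∸ suc a) (F (suc a))
    last-row rewrite ℕₚ.n∸n≡0 a = refl

module NatCast where

  open import Defs
  open import Data.Nat as ℕ using (ℕ; suc; NonZero)
  open import Data.Integer as ℤ using (+_)
  import Data.Integer.Properties as ℤₚ
  import Data.Nat.Properties as ℕₚ
  open import Data.Rational using (1ℚ; _+_; _*_; _/_; toℚᵘ)
  open import Data.Rational.Properties
  open import Data.Rational.Unnormalised as ℚᵘ using (mkℚᵘ; *≡*; _≃_)
  import Data.Rational.Unnormalised.Properties as ℚᵘₚ
  open import Data.Rational.Solver using (module +-*-Solver)
  open import Relation.Binary.PropositionalEquality

  private
    toℚᵘ-fromNat : ∀ n → toℚᵘ (fromNat n) ≃ mkℚᵘ (+ n) 0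
    toℚᵘ-fromNat n = toℚᵘ-fromℚᵘ (mkℚᵘ (+ n) 0)

    +-mkℚᵘ : ∀ m n → mkℚᵘ (+ (m ℕ.+ n)) 0 ≃ (mkℚᵘ (+ m) 0 ℚᵘ.+ mkℚᵘ (+ n) 0)
    +-mkℚᵘ m n = *≡* (begin
      + (m ℕ.+ n) ℤ.* + 1                   ≡⟨ ℤₚ.*-identityʳ _ ⟩
      + (m ℕ.+ n)                           ≡⟨ ℤₚ.pos-+ m n ⟩
      + m ℤ.+ + n                           ≡⟨ sym (cong₂ ℤ._+_ (ℤₚ.*-identityʳ (+ m)) (ℤₚ.*-identityʳ (+ n))) ⟩
      + m ℤ.* + 1 ℤ.+ + n ℤ.* + 1           ≡⟨ sym (ℤₚ.*-identityʳ _) ⟩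
      (+ m ℤ.* + 1 ℤ.+ + n ℤ.* + 1) ℤ.* + 1 ∎)
      where open ≡-Reasoning

    *-mkℚᵘ : ∀ m n → mkℚᵘ (+ (m ℕ.* n)) 0 ≃ (mkℚᵘ (+ m) 0 ℚᵘ.* mkℚᵘ (+ n) 0)
    *-mkℚᵘ m n = *≡* (cong (ℤ._* + 1) (ℤₚ.pos-* m n))

  fromNat-+ : ∀ m n → fromNat (m ℕ.+ n) ≡ fromNat m + fromNat n
  fromNat-+ m n = toℚᵘ-injective (begin
    toℚᵘ (fromNat (m ℕ.+ n))                  ≈⟨ toℚᵘ-fromNat (m ℕ.+ n) ⟩
    mkℚᵘ (+ (m ℕ.+ n)) 0                      ≈⟨ +-mkℚᵘ m n ⟩
    mkℚᵘ (+ m) 0 ℚᵘ.+ mkℚᵘ (+ n) 0            ≈⟨ ℚᵘₚ.+-cong (toℚᵘ-fromNat m) (toℚᵘ-fromNat n) ⟨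
    toℚᵘ (fromNat m) ℚᵘ.+ toℚᵘ (fromNat n)    ≈⟨ toℚᵘ-homo-+ (fromNat m) (fromNat n) ⟨
    toℚᵘ (fromNat m + fromNat n)              ∎)
    where open ℚᵘₚ.≃-Reasoning

  fromNat-* : ∀ m n → fromNat (m ℕ.* n) ≡ fromNat m * fromNat n
  fromNat-* m n = toℚᵘ-injective (begin
    toℚᵘ (fromNat (m ℕ.* n))                  ≈⟨ toℚᵘ-fromNat (m ℕ.* n) ⟩
    mkℚᵘ (+ (m ℕ.* n)) 0                      ≈⟨ *-mkℚᵘ m n ⟩
    mkℚᵘ (+ m) 0 ℚᵘ.* mkℚᵘ (+ n) 0            ≈⟨ ℚᵘₚ.*-cong (toℚᵘ-fromNat m) (toℚᵘ-fromNat n) ⟨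
    toℚᵘ (fromNat m) ℚᵘ.* toℚᵘ (fromNat n)    ≈⟨ toℚᵘ-homo-* (fromNat m) (fromNat n) ⟨
    toℚᵘ (fromNat m * fromNat n)              ∎)
    where open ℚᵘₚ.≃-Reasoning

  fromNat-suc : ∀ n → fromNat (suc n) ≡ 1ℚ + fromNat n
  fromNat-suc n = fromNat-+ 1 n

  fromNat-*-/ : ∀ n d .{{_ : NonZero d}} → fromNat d * (+ n / d) ≡ fromNat n
  fromNat-*-/ n (suc d) = toℚᵘ-injective (begin
    toℚᵘ (fromNat (suc d) * (+ n / suc d))                ≈⟨ toℚᵘ-homo-* (fromNat (suc d)) (+ n / suc d) ⟩
    toℚᵘ (fromNat (suc d)) ℚᵘ.* toℚᵘ (+ n / suc d)        ≈⟨ ℚᵘₚ.*-cong (toℚᵘ-fromNat (suc d)) (toℚᵘ-fromℚᵘ (mkℚᵘ (+ n) d)) ⟩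
    mkℚᵘ (+ suc d) 0 ℚᵘ.* mkℚᵘ (+ n) d                    ≈⟨ *≡* (trans (ℤₚ.*-identityʳ _) (trans (ℤₚ.*-comm (+ suc d) (+ n))
        (cong (λ e → + n ℤ.* + e) (sym (ℕₚ.*-identityˡ (suc d)))))) ⟩
    mkℚᵘ (+ n) 0                                          ≈⟨ toℚᵘ-fromNat n ⟨
    toℚᵘ (fromNat n)                                      ∎)
    where open ℚᵘₚ.≃-Reasoning

  *-inverse⇒≡*-* : ∀ x y z → x * y ≡ 1ℚ → z ≡ y * (x * z)
  *-inverse⇒≡*-* x y z xy≡1 = begin
    z              ≡⟨ *-identityˡ z ⟨
    1ℚ * z         ≡⟨ cong (_* z) xy≡1 ⟨
    x * y * z      ≡⟨ solve 3 (λ x y z → x :* y :* z := y :* (x :* z)) refl x y z ⟩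
    y * (x * z)    ∎
    where
    open ≡-Reasoning
    open +-*-Solver

  /-unique : ∀ n d .{{_ : NonZero d}} q → fromNat d * q ≡ fromNat n → + n / d ≡ q
  /-unique n d q dq≡n = begin
    + n / d                            ≡⟨ *-inverse⇒≡*-* D (+ 1 / d) (+ n / d) (fromNat-*-/ 1 d) ⟩
    + 1 / d * (D * (+ n / d))          ≡⟨ cong (+ 1 / d *_) (trans (fromNat-*-/ n d) (sym dq≡n)) ⟩
    + 1 / d * (D * q)                  ≡⟨ *-inverse⇒≡*-* D (+ 1 / d) q (fromNat-*-/ 1 d) ⟨
    q                                  ∎
    where
    open ≡-Reasoning
    D = fromNat d

module PowerSeries where

  open import Defs
  open FiniteSum
  open import Data.Nat as ℕ using (ℕ; suc; _∸_; _≤_)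
  import Data.Nat.Properties as ℕₚ
  open import Data.Rational using (ℚ; 0ℚ; 1ℚ; _+_; _*_; -_)
  open import Data.Rational.Properties
  open import Data.Product using (_,_)
  open import Algebra.Bundles using (CommutativeRing)
  open import Algebra.Structures using (IsCommutativeRing)
  open import Relation.Binary.PropositionalEquality

  infix 4 _≈F_
  _≈F_ : FPS → FPS → Set
  f ≈F g = ∀ a b → f a b ≡ g a b

  zeroF : FPS
  zeroF _ _ = 0ℚ

  negF : FPS → FPS
  negF f a b = - f a b

  ⊕-cong : ∀ {f f' g g'} → f ≈F f' → g ≈F g' → (f ⊕ g) ≈F (f' ⊕ g')
  ⊕-cong f≈f' g≈g' a b = cong₂ _+_ (f≈f' a b) (g≈g' a b)

  ⊛-cong : ∀ {f f' g g'} → f ≈F f' → g ≈F g' → (f ⊛ g) ≈F (f' ⊛ g')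
  ⊛-cong f≈f' g≈g' a b =
    sumTo-cong a (λ i _ → sumTo-cong b (λ j _ → cong₂ _*_ (f≈f' i j) (g≈g' (a ∸ i) (b ∸ j))))

  ⊛-congˡ : ∀ h {f g} → f ≈F g → (h ⊛ f) ≈F (h ⊛ g)
  ⊛-congˡ h f≈g = ⊛-cong {h} {h} (λ _ _ → refl) f≈g

  ⊛-congʳ : ∀ h {f g} → f ≈F g → (f ⊛ h) ≈F (g ⊛ h)
  ⊛-congʳ h {f} {g} f≈g = ⊛-cong {f} {g} {h} {h} f≈g (λ _ _ → refl)

  ⊛-comm : ∀ f g → (f ⊛ g) ≈F (g ⊛ f)
  ⊛-comm f g a b = begin
    sumTo a (λ i → sumTo b (λ j → f i j * g (a ∸ i) (b ∸ j)))
      ≡⟨ sumTo-reverse a _ ⟩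
    sumTo a (λ i → sumTo b (λ j → f (a ∸ i) j * g (a ∸ (a ∸ i)) (b ∸ j)))
      ≡⟨ sumTo-cong a (λ i _ → sumTo-reverse b _) ⟩
    sumTo a (λ i → sumTo b (λ j → f (a ∸ i) (b ∸ j) * g (a ∸ (a ∸ i)) (b ∸ (b ∸ j))))
      ≡⟨ sumTo-cong a (λ i i≤a → sumTo-cong b (λ j j≤b →
           trans (*-comm (f (a ∸ i) (b ∸ j)) _)
                 (cong₂ (λ x y → g x y * f (a ∸ i) (b ∸ j)) (ℕₚ.m∸[m∸n]≡n i≤a) (ℕₚ.m∸[m∸n]≡n j≤b)))) ⟩
    sumTo a (λ i → sumTo b (λ j → g i j * f (a ∸ i) (b ∸ j)))
      ∎
    where open ≡-Reasoning

  ⊛-identityˡ : ∀ f → (oneF ⊛ f) ≈F f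
  ⊛-identityˡ f a b = begin
    sumTo a (λ i → sumTo b (λ j → oneF i j * f (a ∸ i) (b ∸ j)))
      ≡⟨ sumTo-single a _ (λ { (suc i) _ → sumTo-zero b _ (λ j _ → *-zeroˡ (f (a ∸ suc i) (b ∸ j))) }) ⟩
    sumTo b (λ j → oneF 0 j * f a (b ∸ j))
      ≡⟨ sumTo-single b _ (λ { (suc j) _ → *-zeroˡ (f a (b ∸ suc j)) }) ⟩
    1ℚ * f a b
      ≡⟨ *-identityˡ (f a b) ⟩
    f a b
      ∎
    where open ≡-Reasoning

  ⊛-identityʳ : ∀ f → (f ⊛ oneF) ≈F f
  ⊛-identityʳ f a b = trans (⊛-comm f oneF a b) (⊛-identityˡ f a b)

  ⊛-zeroʳ : ∀ f → (f ⊛ zeroF) ≈F zeroF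
  ⊛-zeroʳ f a b = sumTo-zero a _ (λ i _ → sumTo-zero b _ (λ j _ → *-zeroʳ (f i j)))

  ⊛-zeroˡ : ∀ f → (zeroF ⊛ f) ≈F zeroF
  ⊛-zeroˡ f a b = trans (⊛-comm zeroF f a b) (⊛-zeroʳ f a b)

  ⊕-identityˡ : ∀ f → (zeroF ⊕ f) ≈F f
  ⊕-identityˡ f a b = +-identityˡ (f a b)

  ⊕-identityʳ : ∀ f → (f ⊕ zeroF) ≈F f
  ⊕-identityʳ f a b = +-identityʳ (f a b)

  ⊛-distribˡ : ∀ f g h → (f ⊛ (g ⊕ h)) ≈F ((f ⊛ g) ⊕ (f ⊛ h))
  ⊛-distribˡ f g h a b = begin
    sumTo a (λ i → sumTo b (λ j → f i j * (g (a ∸ i) (b ∸ j) + h (a ∸ i) (b ∸ j))))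
      ≡⟨ sumTo-cong a (λ i _ → sumTo-cong b (λ j _ → *-distribˡ-+ (f i j) _ _)) ⟩
    sumTo a (λ i → sumTo b (λ j → f i j * g (a ∸ i) (b ∸ j) + f i j * h (a ∸ i) (b ∸ j)))
      ≡⟨ sumTo-cong a (λ i _ → sumTo-+ b _ _) ⟩
    sumTo a (λ i → sumTo b (λ j → f i j * g (a ∸ i) (b ∸ j)) + sumTo b (λ j → f i j * h (a ∸ i) (b ∸ j)))
      ≡⟨ sumTo-+ a _ _ ⟩
    (f ⊛ g) a b + (f ⊛ h) a b
      ∎
    where open ≡-Reasoning

  ⊛-distribʳ : ∀ f g h → ((g ⊕ h) ⊛ f) ≈F ((g ⊛ f) ⊕ (h ⊛ f))
  ⊛-distribʳ f g h a b =
    trans (⊛-comm (g ⊕ h) f a b)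
          (trans (⊛-distribˡ f g h a b) (cong₂ _+_ (⊛-comm f g a b) (⊛-comm f h a b)))

  ⊛-assoc : ∀ f g h → ((f ⊛ g) ⊛ h) ≈F (f ⊛ (g ⊛ h))
  ⊛-assoc f g h a b = begin
    sumTo a (λ i → sumTo b (λ j → (f ⊛ g) i j * h (a ∸ i) (b ∸ j)))
      ≡⟨ sumTo-cong a (λ i i≤a → sumTo-cong b (λ j j≤b → expand i j)) ⟩
    sumTo a (λ i → sumTo b (λ j → sumTo i (λ i' → sumTo j (λ j' → T i' (i ∸ i') j' (j ∸ j')))))
      ≡⟨ sumTo-cong a (λ i _ → sumTo-comm b i _) ⟩
    sumTo a (λ i → sumTo i (λ i' → sumTo b (λ j → sumTo j (λ j' → T i' (i ∸ i') j' (j ∸ j')))))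
      ≡⟨ sumTo-triangle a (λ i' k → sumTo b (λ j → sumTo j (λ j' → T i' k j' (j ∸ j')))) ⟩
    sumTo a (λ i' → sumTo (a ∸ i') (λ k → sumTo b (λ j → sumTo j (λ j' → T i' k j' (j ∸ j')))))
      ≡⟨ sumTo-cong a (λ i' _ → sumTo-cong (a ∸ i') (λ k _ → sumTo-triangle b (T i' k))) ⟩
    sumTo a (λ i' → sumTo (a ∸ i') (λ k → sumTo b (λ j' → sumTo (b ∸ j') (T i' k j'))))
      ≡⟨ sumTo-cong a (λ i' _ → sumTo-comm (a ∸ i') b _) ⟩
    sumTo a (λ i' → sumTo b (λ j' → sumTo (a ∸ i') (λ k → sumTo (b ∸ j') (T i' k j'))))
      ≡⟨ sumTo-cong a (λ i' _ → sumTo-cong b (λ j' _ → sym (factor i' j'))) ⟩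
    sumTo a (λ i' → sumTo b (λ j' → f i' j' * (g ⊛ h) (a ∸ i') (b ∸ j')))
      ∎
    where
    open ≡-Reasoning
    T : ℕ → ℕ → ℕ → ℕ → ℚ
    T i' k j' l = f i' j' * (g k l * h (a ∸ i' ∸ k) (b ∸ j' ∸ l))
    ∸-split : ∀ n {i' i} → i' ≤ i → n ∸ i ≡ n ∸ i' ∸ (i ∸ i')
    ∸-split n {i'} {i} i'≤i = sym (trans (ℕₚ.∸-+-assoc n i' (i ∸ i')) (cong (n ∸_) (ℕₚ.m+[n∸m]≡n i'≤i)))
    expand : ∀ i j → (f ⊛ g) i j * h (a ∸ i) (b ∸ j) ≡ sumTo i (λ i' → sumTo j (λ j' → T i' (i ∸ i') j' (j ∸ j')))
    expand i j =
      trans (*-sumToʳ i (h (a ∸ i) (b ∸ j)) _) (sumTo-cong i (λ i' i'≤i →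
      trans (*-sumToʳ j (h (a ∸ i) (b ∸ j)) _) (sumTo-cong j (λ j' j'≤j →
      trans (*-assoc (f i' j') (g (i ∸ i') (j ∸ j')) (h (a ∸ i) (b ∸ j)))
            (cong₂ (λ x y → f i' j' * (g (i ∸ i') (j ∸ j') * h x y)) (∸-split a i'≤i) (∸-split b j'≤j))))))
    factor : ∀ i' j' → f i' j' * (g ⊛ h) (a ∸ i') (b ∸ j') ≡ sumTo (a ∸ i') (λ k → sumTo (b ∸ j') (T i' k j'))
    factor i' j' = trans (*-sumToˡ (a ∸ i') (f i' j') _) (sumTo-cong (a ∸ i') (λ k _ → *-sumToˡ (b ∸ j') (f i' j') _))

  FPS-isCommutativeRing : IsCommutativeRing _≈F_ _⊕_ _⊛_ negF zeroF oneF
  FPS-isCommutativeRing = record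
    { isRing = record
      { +-isAbelianGroup = record
        { isGroup = record
          { isMonoid = record
            { isSemigroup = record
              { isMagma = record
                { isEquivalence = record
                  { refl  = λ _ _ → refl
                  ; sym   = λ f≈g a b → sym (f≈g a b)
                  ; trans = λ f≈g g≈h a b → trans (f≈g a b) (g≈h a b)
                  }
                ; ∙-cong = ⊕-cong
                }
              ; assoc = λ f g h a b → +-assoc (f a b) (g a b) (h a b)
              }
            ; identity = (λ f a b → +-identityˡ (f a b)) , (λ f a b → +-identityʳ (f a b))
            }
          ; inverse = (λ f a b → +-inverseˡ (f a b)) , (λ f a b → +-inverseʳ (f a b))
          ; ⁻¹-cong = λ f≈g a b → cong -_ (f≈g a b)
          }
        ; comm = λ f g a b → +-comm (f a b) (g a b)
        }
      ; *-cong     = ⊛-cong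
      ; *-assoc    = ⊛-assoc
      ; *-identity = ⊛-identityˡ , ⊛-identityʳ
      ; distrib    = ⊛-distribˡ , ⊛-distribʳ
      }
    ; *-comm = ⊛-comm
    }

  FPS-commutativeRing : CommutativeRing _ _
  FPS-commutativeRing = record { isCommutativeRing = FPS-isCommutativeRing }

module SeriesSolver where

  open import Defs
  open FiniteSum
  open PowerSeries
  open import Data.Nat using (_∸_)
  open import Data.Maybe using (Maybe; just; nothing)
  open import Data.Rational using (ℚ; 1ℚ; _*_)
  open import Data.Rational.Properties as ℚₚ using (_≟_)
  open import Algebra.Bundles using (CommutativeRing; RawRing)
  open import Algebra.Solver.Ring.AlmostCommutativeRing
    using (AlmostCommutativeRing; fromCommutativeRing; _-Raw-AlmostCommutative⟶_)
  open import Relation.Binary.PropositionalEquality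
  open import Relation.Nullary using (yes; no)

  constF : ℚ → FPS
  constF c a b = c * oneF a b

  constF-1 : constF 1ℚ ≈F oneF
  constF-1 a b = ℚₚ.*-identityˡ (oneF a b)

  constF-⊛ : ∀ c f → (constF c ⊛ f) ≈F (λ a b → c * f a b)
  constF-⊛ c f a b = begin
    sumTo a (λ i → sumTo b (λ j → c * oneF i j * f (a ∸ i) (b ∸ j)))
      ≡⟨ sumTo-cong a (λ i _ → sumTo-cong b (λ j _ → ℚₚ.*-assoc c (oneF i j) (f (a ∸ i) (b ∸ j)))) ⟩
    sumTo a (λ i → sumTo b (λ j → c * (oneF i j * f (a ∸ i) (b ∸ j))))
      ≡⟨ sumTo-cong a (λ i _ → *-sumToˡ b c _) ⟨
    sumTo a (λ i → c * sumTo b (λ j → oneF i j * f (a ∸ i) (b ∸ j)))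
      ≡⟨ *-sumToˡ a c _ ⟨
    c * (oneF ⊛ f) a b
      ≡⟨ cong (c *_) (⊛-identityˡ f a b) ⟩
    c * f a b
      ∎
    where open ≡-Reasoning

  private
    ℚ-rawRing : RawRing _ _
    ℚ-rawRing = CommutativeRing.rawRing ℚₚ.+-*-commutativeRing

    FPS-almostCommutativeRing : AlmostCommutativeRing _ _
    FPS-almostCommutativeRing = fromCommutativeRing FPS-commutativeRing

    constF-homomorphism : ℚ-rawRing -Raw-AlmostCommutative⟶ FPS-almostCommutativeRing
    constF-homomorphism = record
      { ⟦_⟧    = constF
      ; +-homo = λ x y a b → ℚₚ.*-distribʳ-+ (oneF a b) x y
      ; *-homo = λ x y a b → trans (ℚₚ.*-assoc x y (oneF a b)) (sym (constF-⊛ x (constF y) a b))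
      ; -‿homo = λ x a b → sym (ℚₚ.neg-distribˡ-* x (oneF a b))
      ; 0-homo = λ a b → ℚₚ.*-zeroˡ (oneF a b)
      ; 1-homo = constF-1
      }

    constF-≟ : ∀ x y → Maybe (constF x ≈F constF y)
    constF-≟ x y with x ≟ y
    ... | yes refl = just (λ _ _ → refl)
    ... | no _     = nothing

  open import Algebra.Solver.Ring ℚ-rawRing FPS-almostCommutativeRing constF-homomorphism constF-≟ public
    using (solve; _:=_; _:+_; _:*_; _:-_; con)
  open CommutativeRing FPS-commutativeRing public
    using () renaming (setoid to ≈F-setoid; refl to ≈F-refl; sym to ≈F-sym; trans to ≈F-trans)

  affine-fixedPoint : ∀ P Q D E → Q ≈F (oneF ⊕ (P ⊛ Q)) → D ≈F (E ⊕ (P ⊛ D)) → D ≈F (Q ⊛ E)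
  affine-fixedPoint P Q D E Q≈1+PQ D≈E+PD = begin
    D                                ≈⟨ ≈F-sym (⊛-identityˡ D) ⟩
    oneF ⊛ D                         ≈⟨ ⊛-congʳ D (≈F-sym Q-PQ≈1) ⟩
    (Q ⊕ negF (P ⊛ Q)) ⊛ D           ≈⟨ solve 3 (λ q p d → (q :- p :* q) :* d := q :* (d :- p :* d)) ≈F-refl Q P D ⟩
    Q ⊛ (D ⊕ negF (P ⊛ D))           ≈⟨ ⊛-congˡ Q D-PD≈E ⟩
    Q ⊛ E                            ∎
    where
    open import Relation.Binary.Reasoning.Setoid ≈F-setoid
    Q-PQ≈1 : (Q ⊕ negF (P ⊛ Q)) ≈F oneF
    Q-PQ≈1 = ≈F-trans (⊕-cong Q≈1+PQ (λ _ _ → refl))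
                      (solve 3 (λ o q p → (o :+ p :* q) :- p :* q := o) ≈F-refl oneF Q P)
    D-PD≈E : (D ⊕ negF (P ⊛ D)) ≈F E
    D-PD≈E = ≈F-trans (⊕-cong D≈E+PD (λ _ _ → refl))
                      (solve 3 (λ e p d → (e :+ p :* d) :- p :* d := e) ≈F-refl E P D)

module Derivation where

  open import Defs
  open FiniteSum
  open NatCast
  open PowerSeries
  open SeriesSolver hiding (solve; _:=_; _:+_; _:*_; _:-_; con)
  open import Data.Nat as ℕ using (ℕ; zero; suc; _∸_; _≤_; _!)
  import Data.Nat.Properties as ℕₚ
  open import Data.Nat.Properties using (_!≢0)
  open import Data.Integer using (+_)
  open import Data.Rational using (ℚ; 0ℚ; 1ℚ; _+_; _*_; _/_)
  open import Data.Rational.Properties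
  open import Data.Rational.Solver using (module +-*-Solver)
  open import Relation.Binary.PropositionalEquality

  dx : FPS → FPS
  dx f a b = fromNat (suc a) * f (suc a) b

  dy : FPS → FPS
  dy f a b = fromNat (suc b) * f a (suc b)

  transpose : FPS → FPS
  transpose f a b = f b a

  record IsDerivation (d : FPS → FPS) : Set where
    field
      d-cong : ∀ {f g} → f ≈F g → d f ≈F d g
      d-⊕    : ∀ f g → d (f ⊕ g) ≈F (d f ⊕ d g)
      d-oneF : d oneF ≈F zeroF
      d-⊛    : ∀ f g → d (f ⊛ g) ≈F ((d f ⊛ g) ⊕ (f ⊛ d g))

  dx-⊛ : ∀ f g → dx (f ⊛ g) ≈F ((dx f ⊛ g) ⊕ (f ⊛ dx g))
  dx-⊛ f g a b = begin
    fromNat (suc a) * sumTo (suc a) (λ i → sumTo b (λ j → f i j * g (suc a ∸ i) (b ∸ j)))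
      ≡⟨ trans (*-sumToˡ (suc a) (fromNat (suc a)) _) (sumTo-cong (suc a) (λ i _ → *-sumToˡ b (fromNat (suc a)) _)) ⟩
    sumTo (suc a) (λ i → sumTo b (λ j → fromNat (suc a) * (f i j * g (suc a ∸ i) (b ∸ j))))
      ≡⟨ sumTo-cong (suc a) (λ i i≤1+a → sumTo-cong b (λ j _ → split-weight i≤1+a (f i j) (g (suc a ∸ i) (b ∸ j)))) ⟩
    sumTo (suc a) (λ i → sumTo b (λ j → A i j + B i j))
      ≡⟨ trans (sumTo-cong (suc a) (λ i _ → sumTo-+ b (A i) (B i))) (sumTo-+ (suc a) _ _) ⟩
    sumTo (suc a) (λ i → sumTo b (A i)) + sumTo (suc a) (λ i → sumTo b (B i))
      ≡⟨ cong₂ _+_ A-sum B-sum ⟩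
    (dx f ⊛ g) a b + (f ⊛ dx g) a b
      ∎
    where
    open ≡-Reasoning
    open +-*-Solver
    A B : ℕ → ℕ → ℚ
    A i j = (fromNat i * f i j) * g (suc a ∸ i) (b ∸ j)
    B i j = f i j * (fromNat (suc a ∸ i) * g (suc a ∸ i) (b ∸ j))
    -- the weight a + 1 of x^(a+1) is shared between the two factors as i + (a + 1 - i)
    split-weight : ∀ {i} → i ≤ suc a → ∀ u v →
                   fromNat (suc a) * (u * v) ≡ (fromNat i * u) * v + u * (fromNat (suc a ∸ i) * v)
    split-weight {i} i≤1+a u v = begin
      fromNat (suc a) * (u * v)                 ≡⟨ cong (λ n → fromNat n * (u * v)) (ℕₚ.m+[n∸m]≡n i≤1+a) ⟨
      fromNat (i ℕ.+ (suc a ∸ i)) * (u * v)     ≡⟨ cong (_* (u * v)) (fromNat-+ i (suc a ∸ i)) ⟩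
      (fromNat i + fromNat (suc a ∸ i)) * (u * v)
        ≡⟨ solve 4 (λ x y u v → (x :+ y) :* (u :* v) := (x :* u) :* v :+ u :* (y :* v)) refl
             (fromNat i) (fromNat (suc a ∸ i)) u v ⟩
      (fromNat i * u) * v + u * (fromNat (suc a ∸ i) * v) ∎
    A-sum : sumTo (suc a) (λ i → sumTo b (A i)) ≡ (dx f ⊛ g) a b
    A-sum = begin
      sumTo (suc a) (λ i → sumTo b (A i))            ≡⟨ sumTo-suc a _ ⟩
      sumTo b (A 0) + (dx f ⊛ g) a b                 ≡⟨ cong (_+ (dx f ⊛ g) a b)
                                                          (sumTo-zero b (A 0) (λ j _ → trans (cong (_* g (suc a) (b ∸ j)) (*-zeroˡ (f 0 j)))
                                                                                            (*-zeroˡ (g (suc a) (b ∸ j))))) ⟩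
      0ℚ + (dx f ⊛ g) a b                            ≡⟨ +-identityˡ _ ⟩
      (dx f ⊛ g) a b                                 ∎
    B-sum : sumTo (suc a) (λ i → sumTo b (B i)) ≡ (f ⊛ dx g) a b
    B-sum = begin
      sumTo a (λ i → sumTo b (B i)) + sumTo b (B (suc a))
        ≡⟨ cong (sumTo a (λ i → sumTo b (B i)) Data.Rational.+_) (sumTo-zero b (B (suc a)) (λ j _ → last-zero j)) ⟩
      sumTo a (λ i → sumTo b (B i)) + 0ℚ
        ≡⟨ +-identityʳ _ ⟩
      sumTo a (λ i → sumTo b (B i))
        ≡⟨ sumTo-cong a (λ i i≤a → sumTo-cong b (λ j _ →
             cong (λ n → f i j * (fromNat n * g n (b ∸ j))) (ℕₚ.+-∸-assoc 1 i≤a))) ⟩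
      (f ⊛ dx g) a b
        ∎
      where
      last-zero : ∀ j → B (suc a) j ≡ 0ℚ
      last-zero j rewrite ℕₚ.n∸n≡0 a = trans (cong (f (suc a) j *_) (*-zeroˡ (g 0 (b ∸ j)))) (*-zeroʳ (f (suc a) j))

  transpose-⊛ : ∀ f g → transpose (f ⊛ g) ≈F (transpose f ⊛ transpose g)
  transpose-⊛ f g a b = sumTo-comm b a _

  dy-⊛ : ∀ f g → dy (f ⊛ g) ≈F ((dy f ⊛ g) ⊕ (f ⊛ dy g))
  dy-⊛ f g a b = begin
    dy (f ⊛ g) a b                                                    ≡⟨ cong (fromNat (suc b) *_) (transpose-⊛ f g (suc b) a) ⟩
    dx (transpose f ⊛ transpose g) b a                                ≡⟨ dx-⊛ (transpose f) (transpose g) b a ⟩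
    (dx (transpose f) ⊛ transpose g) b a + (transpose f ⊛ dx (transpose g)) b a
      ≡⟨ cong₂ _+_ (transpose-⊛ (dy f) g b a) (transpose-⊛ f (dy g) b a) ⟨
    (dy f ⊛ g) a b + (f ⊛ dy g) a b                                   ∎
    where open ≡-Reasoning

  dx-isDerivation : IsDerivation dx
  dx-isDerivation = record
    { d-cong = λ f≈g a b → cong (fromNat (suc a) *_) (f≈g (suc a) b)
    ; d-⊕    = λ f g a b → *-distribˡ-+ (fromNat (suc a)) (f (suc a) b) (g (suc a) b)
    ; d-oneF = λ a b → *-zeroʳ (fromNat (suc a))
    ; d-⊛    = dx-⊛
    }

  dy-isDerivation : IsDerivation dy
  dy-isDerivation = record
    { d-cong = λ f≈g a b → cong (fromNat (suc b) *_) (f≈g a (suc b))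
    ; d-⊕    = λ f g a b → *-distribˡ-+ (fromNat (suc b)) (f a (suc b)) (g a (suc b))
    ; d-oneF = λ { zero b → *-zeroʳ (fromNat (suc b)) ; (suc a) b → *-zeroʳ (fromNat (suc b)) }
    ; d-⊛    = dy-⊛
    }

  1/_! : ℕ → ℚ
  1/ a ! = + 1 / a !
    where instance _ = a !≢0

  fromNat-suc-*-1/suc! : ∀ a → fromNat (suc a) * 1/ suc a ! ≡ 1/ a !
  fromNat-suc-*-1/suc! a = sym (/-unique 1 (a !) _ (begin
    fromNat (a !) * (fromNat (suc a) * 1/ suc a !)    ≡⟨ *-assoc (fromNat (a !)) _ _ ⟨
    fromNat (a !) * fromNat (suc a) * 1/ suc a !      ≡⟨ cong (_* 1/ suc a !) (fromNat-* (a !) (suc a)) ⟨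
    fromNat (a ! ℕ.* suc a) * 1/ suc a !             ≡⟨ cong (λ n → fromNat n * 1/ suc a !) (ℕₚ.*-comm (a !) (suc a)) ⟩
    fromNat (suc a !) * 1/ suc a !                    ≡⟨ fromNat-*-/ 1 (suc a !) ⟩
    fromNat 1                                         ∎))
    where
    open ≡-Reasoning
    instance
      _ = a !≢0
      _ = suc a !≢0

  dx-expX : dx expX ≈F expX
  dx-expX a zero    = fromNat-suc-*-1/suc! a
  dx-expX a (suc b) = *-zeroʳ (fromNat (suc a))

  dy-expY : dy expY ≈F expY
  dy-expY zero    b = fromNat-suc-*-1/suc! b
  dy-expY (suc a) b = *-zeroʳ (fromNat (suc b))

  dy-expX : dy expX ≈F zeroF
  dy-expX a b = *-zeroʳ (fromNat (suc b))

  module _ {d : FPS → FPS} (isDerivation : IsDerivation d) where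
    open IsDerivation isDerivation
    open import Relation.Binary.Reasoning.Setoid ≈F-setoid
    open SeriesSolver using (solve; _:=_; _:+_; _:*_; con)

    d-geometric : ∀ P Q → Q ≈F (oneF ⊕ (P ⊛ Q)) → d Q ≈F (Q ⊛ (d P ⊛ Q))
    d-geometric P Q Q≈1+PQ = affine-fixedPoint P Q (d Q) (d P ⊛ Q) Q≈1+PQ (begin
      d Q                                ≈⟨ d-cong Q≈1+PQ ⟩
      d (oneF ⊕ (P ⊛ Q))                 ≈⟨ d-⊕ oneF (P ⊛ Q) ⟩
      d oneF ⊕ d (P ⊛ Q)                 ≈⟨ ⊕-cong d-oneF (d-⊛ P Q) ⟩
      zeroF ⊕ ((d P ⊛ Q) ⊕ (P ⊛ d Q))    ≈⟨ (λ a b → +-identityˡ _) ⟩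
      (d P ⊛ Q) ⊕ (P ⊛ d Q)              ∎)

    d-^F : ∀ P k → d (P ^F suc k) ≈F (constF (fromNat (suc k)) ⊛ ((P ^F k) ⊛ d P))
    d-^F P zero = begin
      d (P ⊛ oneF)                       ≈⟨ d-⊛ P oneF ⟩
      (d P ⊛ oneF) ⊕ (P ⊛ d oneF)        ≈⟨ ⊕-cong (⊛-identityʳ (d P)) (≈F-trans (⊛-congˡ P d-oneF) (⊛-zeroʳ P)) ⟩
      d P ⊕ zeroF                        ≈⟨ (λ a b → +-identityʳ (d P a b)) ⟩
      d P                                ≈⟨ ≈F-sym (⊛-identityˡ (d P)) ⟩
      oneF ⊛ d P                         ≈⟨ ≈F-sym (⊛-identityˡ (oneF ⊛ d P)) ⟩
      oneF ⊛ (oneF ⊛ d P)                ≈⟨ ⊛-congʳ (oneF ⊛ d P) (≈F-sym constF-1) ⟩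
      constF 1ℚ ⊛ (oneF ⊛ d P)           ∎
    d-^F P (suc k) = begin
      d (P ⊛ (P ^F suc k))
        ≈⟨ d-⊛ P (P ^F suc k) ⟩
      (d P ⊛ (P ⊛ (P ^F k))) ⊕ (P ⊛ d (P ^F suc k))
        ≈⟨ ⊕-cong {d P ⊛ (P ⊛ (P ^F k))} (λ _ _ → refl) (⊛-congˡ P (d-^F P k)) ⟩
      (d P ⊛ (P ⊛ (P ^F k))) ⊕ (P ⊛ (constF (fromNat (suc k)) ⊛ ((P ^F k) ⊛ d P)))
        ≈⟨ solve 4 (λ p′ p r n → p′ :* (p :* r) :+ p :* (n :* (r :* p′)) := (con 1ℚ :+ n) :* ((p :* r) :* p′))
             ≈F-refl (d P) P (P ^F k) (constF (fromNat (suc k))) ⟩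
      (constF 1ℚ ⊕ constF (fromNat (suc k))) ⊛ ((P ⊛ (P ^F k)) ⊛ d P)
        ≈⟨ ⊛-congʳ ((P ⊛ (P ^F k)) ⊛ d P) (λ a b →
             trans (sym (*-distribʳ-+ (oneF a b) 1ℚ (fromNat (suc k)))) (cong (_* oneF a b) (sym (fromNat-suc (suc k))))) ⟩
      constF (fromNat (suc (suc k))) ⊛ ((P ⊛ (P ^F k)) ⊛ d P)
        ∎

module Substitution (u : FPS) (u-x⁰ : ∀ b → u 0 b ≡ 0ℚ) (u-y⁰ : ∀ a → u a 0 ≡ 0ℚ) where
  open import Defs
  open FiniteSum
  open NatCast
  open PowerSeries
  open SeriesSolver hiding (solve; _:=_; _:+_; _:*_; _:-_; con)
  open Derivation
  open import Data.Nat as ℕ using (ℕ; zero; suc; _∸_; _≤_; _<_; z≤n; s≤s)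
  import Data.Nat.Properties as ℕₚ
  open import Data.Rational using (0ℚ; 1ℚ; _+_; _*_; _/_)
  open import Data.Rational.Properties
  open import Relation.Binary.PropositionalEquality

  private
    x*[y*z]≡y*[x*z] : ∀ x y z → x * (y * z) ≡ y * (x * z)
    x*[y*z]≡y*[x*z] x y z = trans (sym (*-assoc x y z)) (trans (cong (_* z) (*-comm x y)) (*-assoc y x z))

    ∸-suc-< : ∀ {a k i} → suc i ≤ a → a ≤ k → a ∸ suc i < k
    ∸-suc-< {suc a} {k} {i} _ a≤k = ℕₚ.<-≤-trans (s≤s (ℕₚ.m∸n≤m a i)) a≤k

  ^F-x-order : ∀ k a b → a < k → (u ^F k) a b ≡ 0ℚ
  ^F-x-order (suc k) a b (s≤s a≤k) = sumTo-zero a _ (λ i i≤a → sumTo-zero b _ (λ j _ → term i j i≤a))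
    where
    term : ∀ i j → i ≤ a → u i j * (u ^F k) (a ∸ i) (b ∸ j) ≡ 0ℚ
    term zero    j _   = trans (cong (_* (u ^F k) a (b ∸ j)) (u-x⁰ j)) (*-zeroˡ ((u ^F k) a (b ∸ j)))
    term (suc i) j i<a = trans (cong (u (suc i) j *_) (^F-x-order k (a ∸ suc i) (b ∸ j) (∸-suc-< i<a a≤k))) (*-zeroʳ (u (suc i) j))

  ^F-y-order : ∀ k a b → b < k → (u ^F k) a b ≡ 0ℚ
  ^F-y-order (suc k) a b (s≤s b≤k) = sumTo-zero a _ (λ i _ → sumTo-zero b _ (λ j j≤b → term i j j≤b))
    where
    term : ∀ i j → j ≤ b → u i j * (u ^F k) (a ∸ i) (b ∸ j) ≡ 0ℚ
    term i zero    _   = trans (cong (_* (u ^F k) (a ∸ i) b) (u-y⁰ i)) (*-zeroˡ ((u ^F k) (a ∸ i) b))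
    term i (suc j) j<b = trans (cong (u i (suc j) *_) (^F-y-order k (a ∸ i) (b ∸ suc j) (∸-suc-< j<b b≤k))) (*-zeroʳ (u i (suc j)))

  -- substF truncates its sum at a + b, but any bound ≥ a (or ≥ b) gives the same coefficient
  substF-x-range : ∀ c a b n → a ≤ n → substF c u a b ≡ sumTo n (λ k → c k * (u ^F k) a b)
  substF-x-range c a b n a≤n =
    trans (sumTo-extend a (a ℕ.+ b) _ vanish (ℕₚ.m≤m+n a b)) (sym (sumTo-extend a n _ vanish a≤n))
    where
    vanish : ∀ k → a < k → c k * (u ^F k) a b ≡ 0ℚ
    vanish k a<k = trans (cong (c k *_) (^F-x-order k a b a<k)) (*-zeroʳ (c k))

  substF-y-range : ∀ c a b n → b ≤ n → substF c u a b ≡ sumTo n (λ k → c k * (u ^F k) a b)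
  substF-y-range c a b n b≤n =
    trans (sumTo-extend b (a ℕ.+ b) _ vanish (ℕₚ.m≤n+m b a)) (sym (sumTo-extend b n _ vanish b≤n))
    where
    vanish : ∀ k → b < k → c k * (u ^F k) a b ≡ 0ℚ
    vanish k b<k = trans (cong (c k *_) (^F-y-order k a b b<k)) (*-zeroʳ (c k))

  substF-suc : ∀ c a b → substF c u a b ≡ c 0 * oneF a b + sumTo a (λ k → c (suc k) * (u ^F suc k) a b)
  substF-suc c a b = trans (substF-x-range c a b (suc a) (ℕₚ.n≤1+n a)) (sumTo-suc a _)

  ⊛-substF : ∀ c g a b → (g ⊛ substF c u) a b ≡ sumTo a (λ k → c k * (g ⊛ (u ^F k)) a b)
  ⊛-substF c g a b = begin
    sumTo a (λ i → sumTo b (λ j → g i j * substF c u (a ∸ i) (b ∸ j)))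
      ≡⟨ sumTo-cong a (λ i _ → sumTo-cong b (λ j _ →
           trans (cong (g i j *_) (substF-x-range c (a ∸ i) (b ∸ j) a (ℕₚ.m∸n≤m a i))) (*-sumToˡ a (g i j) _))) ⟩
    sumTo a (λ i → sumTo b (λ j → sumTo a (λ k → g i j * (c k * (u ^F k) (a ∸ i) (b ∸ j)))))
      ≡⟨ trans (sumTo-cong a (λ i _ → sumTo-comm b a _)) (sumTo-comm a a _) ⟩
    sumTo a (λ k → sumTo a (λ i → sumTo b (λ j → g i j * (c k * (u ^F k) (a ∸ i) (b ∸ j)))))
      ≡⟨ sumTo-cong a (λ k _ → sym (trans (*-sumToˡ a (c k) _) (sumTo-cong a (λ i _ →
           trans (*-sumToˡ b (c k) _) (sumTo-cong b (λ j _ → x*[y*z]≡y*[x*z] (c k) (g i j) _)))))) ⟩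
    sumTo a (λ k → c k * (g ⊛ (u ^F k)) a b)
      ∎
    where open ≡-Reasoning

  invOneMinus : FPS
  invOneMinus = substF (λ _ → 1ℚ) u

  invOneMinus-≈ : invOneMinus ≈F (oneF ⊕ (u ⊛ invOneMinus))
  invOneMinus-≈ a b =
    trans (substF-suc (λ _ → 1ℚ) a b)
          (cong₂ _+_ (*-identityˡ (oneF a b)) (sym (⊛-substF (λ _ → 1ℚ) u a b)))

  invSqOneMinus-≈ : substF invSqOneMinus u ≈F (invOneMinus ⊛ invOneMinus)
  invSqOneMinus-≈ = affine-fixedPoint u invOneMinus S invOneMinus invOneMinus-≈ S≈Q+uS
    where
    S = substF invSqOneMinus u
    S≈Q+uS : S ≈F (invOneMinus ⊕ (u ⊛ S))
    S≈Q+uS a b = begin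
      S a b
        ≡⟨ substF-suc invSqOneMinus a b ⟩
      fromNat 1 * oneF a b + sumTo a (λ k → fromNat (suc (suc k)) * (u ^F suc k) a b)
        ≡⟨ cong (fromNat 1 * oneF a b +_) (trans (sumTo-cong a (λ k _ →
             trans (cong (_* (u ^F suc k) a b) (fromNat-suc (suc k))) (*-distribʳ-+ _ 1ℚ (fromNat (suc k)))))
             (sumTo-+ a _ _)) ⟩
      fromNat 1 * oneF a b + (sumTo a (λ k → 1ℚ * (u ^F suc k) a b) + sumTo a (λ k → fromNat (suc k) * (u ^F suc k) a b))
        ≡⟨ sym (+-assoc (fromNat 1 * oneF a b) _ _) ⟩
      (1ℚ * oneF a b + sumTo a (λ k → 1ℚ * (u ^F suc k) a b)) + sumTo a (λ k → fromNat (suc k) * (u ^F suc k) a b)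
        ≡⟨ cong₂ _+_ (sym (substF-suc (λ _ → 1ℚ) a b)) (sym (⊛-substF invSqOneMinus u a b)) ⟩
      invOneMinus a b + (u ⊛ S) a b
        ∎
      where open ≡-Reasoning

  invOneMinus-x⁰ : ∀ b → invOneMinus 0 b ≡ oneF 0 b
  invOneMinus-x⁰ b = trans (substF-x-range (λ _ → 1ℚ) 0 b 0 z≤n) (*-identityˡ (oneF 0 b))

  invOneMinus-y⁰ : ∀ a → invOneMinus a 0 ≡ oneF a 0
  invOneMinus-y⁰ a = trans (substF-y-range (λ _ → 1ℚ) a 0 0 z≤n) (*-identityˡ (oneF a 0))

  substF-x⁰ : ∀ c → c 0 ≡ 0ℚ → ∀ b → substF c u 0 b ≡ 0ℚ
  substF-x⁰ c c₀≡0 b = trans (substF-x-range c 0 b 0 z≤n) (trans (cong (_* oneF 0 b) c₀≡0) (*-zeroˡ (oneF 0 b)))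

  substF-y⁰ : ∀ c → c 0 ≡ 0ℚ → ∀ a → substF c u a 0 ≡ 0ℚ
  substF-y⁰ c c₀≡0 a = trans (substF-y-range c a 0 0 z≤n) (trans (cong (_* oneF a 0) c₀≡0) (*-zeroˡ (oneF a 0)))

  dx-negLogOneMinus : dx (substF negLogOneMinus u) ≈F (invOneMinus ⊛ dx u)
  dx-negLogOneMinus a b = begin
    fromNat (suc a) * sumTo (suc (a ℕ.+ b)) (λ k → c k * (u ^F k) (suc a) b)
      ≡⟨ trans (*-sumToˡ (suc (a ℕ.+ b)) (fromNat (suc a)) _) (sumTo-suc (a ℕ.+ b) _) ⟩
    fromNat (suc a) * (0ℚ * oneF (suc a) b) + sumTo (a ℕ.+ b) (λ k → fromNat (suc a) * (c (suc k) * (u ^F suc k) (suc a) b))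
      ≡⟨ cong₂ _+_ (trans (cong (fromNat (suc a) *_) (*-zeroˡ (oneF (suc a) b))) (*-zeroʳ (fromNat (suc a))))
                   (sumTo-cong (a ℕ.+ b) (λ k _ → term k)) ⟩
    0ℚ + sumTo (a ℕ.+ b) (λ k → ((u ^F k) ⊛ dx u) a b)
      ≡⟨ +-identityˡ _ ⟩
    sumTo (a ℕ.+ b) (λ k → ((u ^F k) ⊛ dx u) a b)
      ≡⟨ sumTo-extend a (a ℕ.+ b) _ high-powers-vanish (ℕₚ.m≤m+n a b) ⟩
    sumTo a (λ k → ((u ^F k) ⊛ dx u) a b)
      ≡⟨ sumTo-cong a (λ k _ → trans (⊛-comm (u ^F k) (dx u) a b) (sym (*-identityˡ _))) ⟩
    sumTo a (λ k → 1ℚ * (dx u ⊛ (u ^F k)) a b)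
      ≡⟨ ⊛-substF (λ _ → 1ℚ) (dx u) a b ⟨
    (dx u ⊛ invOneMinus) a b
      ≡⟨ ⊛-comm (dx u) invOneMinus a b ⟩
    (invOneMinus ⊛ dx u) a b
      ∎
    where
    open ≡-Reasoning
    c = negLogOneMinus
    -- d(uᵏ⁺¹)/(k+1) = uᵏ du: the coefficient 1/(k+1) of -log(1-t) cancels the exponent
    term : ∀ k → fromNat (suc a) * (c (suc k) * (u ^F suc k) (suc a) b) ≡ ((u ^F k) ⊛ dx u) a b
    term k = begin
      fromNat (suc a) * (c (suc k) * (u ^F suc k) (suc a) b)
        ≡⟨ x*[y*z]≡y*[x*z] (fromNat (suc a)) (c (suc k)) _ ⟩
      c (suc k) * dx (u ^F suc k) a b
        ≡⟨ cong (c (suc k) *_) (trans (d-^F dx-isDerivation u k a b) (constF-⊛ (fromNat (suc k)) ((u ^F k) ⊛ dx u) a b)) ⟩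
      c (suc k) * (fromNat (suc k) * ((u ^F k) ⊛ dx u) a b)
        ≡⟨ *-assoc (c (suc k)) (fromNat (suc k)) _ ⟨
      (c (suc k) * fromNat (suc k)) * ((u ^F k) ⊛ dx u) a b
        ≡⟨ cong (_* ((u ^F k) ⊛ dx u) a b) (trans (*-comm (c (suc k)) _) (fromNat-*-/ 1 (suc k))) ⟩
      1ℚ * ((u ^F k) ⊛ dx u) a b
        ≡⟨ *-identityˡ _ ⟩
      ((u ^F k) ⊛ dx u) a b
        ∎
    high-powers-vanish : ∀ k → a < k → ((u ^F k) ⊛ dx u) a b ≡ 0ℚ
    high-powers-vanish k a<k = sumTo-zero a _ (λ i i≤a → sumTo-zero b _ (λ j _ →
      trans (cong (_* dx u (a ∸ i) (b ∸ j)) (^F-x-order k i j (ℕₚ.≤-<-trans i≤a a<k))) (*-zeroˡ (dx u (a ∸ i) (b ∸ j)))))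

module ClosedForm where

  open import Defs
  open FiniteSum
  open PowerSeries
  open SeriesSolver
  open Derivation
  open import Data.Nat as ℕ using (zero; suc; _∸_)
  open import Data.Rational using (0ℚ; 1ℚ; _+_; _*_; -_)
  open import Data.Rational.Properties
  open import Relation.Binary.PropositionalEquality
  open import Relation.Binary.Reasoning.Setoid ≈F-setoid

  one : FPS
  one = constF 1ℚ

  expX-1 : FPS
  expX-1 = expX ⊕ negF one

  expY-1 : FPS
  expY-1 = expY ⊕ negF one

  P-≈ : P ≈F (expX-1 ⊛ expY-1)
  P-≈ = ⊛-cong (λ a b → cong (λ z → expX a b + - z) (sym (constF-1 a b)))
               (λ a b → cong (λ z → expY a b + - z) (sym (constF-1 a b)))

  P-x⁰ : ∀ b → P 0 b ≡ 0ℚ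
  P-x⁰ b = sumTo-zero b _ (λ j _ → trans (cong (_* (expY ⊖ oneF) 0 (b ∸ j)) (expX-1-x⁰ j)) (*-zeroˡ ((expY ⊖ oneF) 0 (b ∸ j))))
    where
    expX-1-x⁰ : ∀ j → (expX ⊖ oneF) 0 j ≡ 0ℚ
    expX-1-x⁰ zero    = refl
    expX-1-x⁰ (suc j) = refl

  P-y⁰ : ∀ a → P a 0 ≡ 0ℚ
  P-y⁰ a = sumTo-zero a _ (λ i _ → trans (cong ((expX ⊖ oneF) i 0 *_) (expY-1-y⁰ (a ∸ i))) (*-zeroʳ ((expX ⊖ oneF) i 0)))
    where
    expY-1-y⁰ : ∀ i → (expY ⊖ oneF) i 0 ≡ 0ℚ
    expY-1-y⁰ zero    = refl
    expY-1-y⁰ (suc i) = refl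

  open Substitution P P-x⁰ P-y⁰ public

  Q : FPS
  Q = invOneMinus

  Q-≈ : Q ≈F (one ⊕ ((expX-1 ⊛ expY-1) ⊛ Q))
  Q-≈ = ≈F-trans invOneMinus-≈ (⊕-cong (≈F-sym constF-1) (⊛-congʳ Q P-≈))

  one-≈ : one ≈F (Q ⊕ negF ((expX-1 ⊛ expY-1) ⊛ Q))
  one-≈ = begin
    one                                                       ≈⟨ solve 2 (λ o r → o := (o :+ r) :- r) ≈F-refl one R ⟩
    (one ⊕ R) ⊕ negF R                                        ≈⟨ ⊕-cong (≈F-sym Q-≈) (λ _ _ → refl) ⟩
    Q ⊕ negF R                                                ∎
    where R = (expX-1 ⊛ expY-1) ⊛ Q

  dx-expX-1 : dx expX-1 ≈F expX
  dx-expX-1 a b = trans (*-distribˡ-+ (fromNat (suc a)) _ _)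
                        (trans (cong₂ _+_ (dx-expX a b) (*-zeroʳ (fromNat (suc a)))) (+-identityʳ _))

  dx-expY-1 : dx expY-1 ≈F zeroF
  dx-expY-1 a b = *-zeroʳ (fromNat (suc a))

  dy-expX-1 : dy expX-1 ≈F zeroF
  dy-expX-1 zero    b = *-zeroʳ (fromNat (suc b))
  dy-expX-1 (suc a) b = *-zeroʳ (fromNat (suc b))

  dy-expY-1 : dy expY-1 ≈F expY
  dy-expY-1 zero    b = trans (*-distribˡ-+ (fromNat (suc b)) _ _)
                              (trans (cong₂ _+_ (dy-expY zero b) (*-zeroʳ (fromNat (suc b)))) (+-identityʳ _))
  dy-expY-1 (suc a) b = *-zeroʳ (fromNat (suc b))

  dx-P : dx P ≈F (expX ⊛ expY-1)
  dx-P = begin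
    dx P                                        ≈⟨ d-cong P-≈ ⟩
    dx (expX-1 ⊛ expY-1)                        ≈⟨ d-⊛ expX-1 expY-1 ⟩
    (dx expX-1 ⊛ expY-1) ⊕ (expX-1 ⊛ dx expY-1) ≈⟨ ⊕-cong (⊛-congʳ expY-1 dx-expX-1) (≈F-trans (⊛-congˡ expX-1 dx-expY-1) (⊛-zeroʳ expX-1)) ⟩
    (expX ⊛ expY-1) ⊕ zeroF                     ≈⟨ ⊕-identityʳ (expX ⊛ expY-1) ⟩
    expX ⊛ expY-1                               ∎
    where open IsDerivation dx-isDerivation

  dy-P : dy P ≈F (expX-1 ⊛ expY)
  dy-P = begin
    dy P                                        ≈⟨ d-cong P-≈ ⟩
    dy (expX-1 ⊛ expY-1)                        ≈⟨ d-⊛ expX-1 expY-1 ⟩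
    (dy expX-1 ⊛ expY-1) ⊕ (expX-1 ⊛ dy expY-1) ≈⟨ ⊕-cong (≈F-trans (⊛-congʳ expY-1 dy-expX-1) (⊛-zeroˡ expY-1)) (⊛-congˡ expX-1 dy-expY-1) ⟩
    zeroF ⊕ (expX-1 ⊛ expY)                     ≈⟨ ⊕-identityˡ (expX-1 ⊛ expY) ⟩
    expX-1 ⊛ expY                               ∎
    where open IsDerivation dy-isDerivation

  dy-dx-P : dy (dx P) ≈F (expX ⊛ expY)
  dy-dx-P = begin
    dy (dx P)                                   ≈⟨ d-cong dx-P ⟩
    dy (expX ⊛ expY-1)                          ≈⟨ d-⊛ expX expY-1 ⟩
    (dy expX ⊛ expY-1) ⊕ (expX ⊛ dy expY-1)     ≈⟨ ⊕-cong (≈F-trans (⊛-congʳ expY-1 dy-expX) (⊛-zeroˡ expY-1)) (⊛-congˡ expX dy-expY-1) ⟩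
    zeroF ⊕ (expX ⊛ expY)                       ≈⟨ ⊕-identityˡ (expX ⊛ expY) ⟩
    expX ⊛ expY                                 ∎
    where open IsDerivation dy-isDerivation

  dx-Q : dx Q ≈F (Q ⊛ ((expX ⊛ expY-1) ⊛ Q))
  dx-Q = ≈F-trans (d-geometric dx-isDerivation P Q invOneMinus-≈) (⊛-congˡ Q (⊛-congʳ Q dx-P))

  dy-Q : dy Q ≈F (Q ⊛ ((expX-1 ⊛ expY) ⊛ Q))
  dy-Q = ≈F-trans (d-geometric dy-isDerivation P Q invOneMinus-≈) (⊛-congˡ Q (⊛-congʳ Q dy-P))

  rhsG-factor : rhsG ≈F ((expX ⊛ Q) ⊛ (expY ⊛ Q))
  rhsG-factor = ≈F-trans (⊛-congˡ (expX ⊛ expY) invSqOneMinus-≈)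
                         (solve 3 (λ x y q → (x :* y) :* (q :* q) := (x :* q) :* (y :* q)) ≈F-refl expX expY Q)

  -- 1 + ∂ₓP/(1 - P) = eʸ/(1 - P), because 1 - P + ∂ₓP = 1 - (eˣ - 1)(eʸ - 1) + eˣ(eʸ - 1) = eʸ
  one⊕dx-P⊛Q : (one ⊕ ((expX ⊛ expY-1) ⊛ Q)) ≈F (expY ⊛ Q)
  one⊕dx-P⊛Q = begin
    one ⊕ ((expX ⊛ expY-1) ⊛ Q)                                    ≈⟨ ⊕-cong one-≈ (λ _ _ → refl) ⟩
    (Q ⊕ negF ((expX-1 ⊛ expY-1) ⊛ Q)) ⊕ ((expX ⊛ expY-1) ⊛ Q)
      ≈⟨ solve 3 (λ x y q → (q :- ((x :- con 1ℚ) :* (y :- con 1ℚ)) :* q) :+ (x :* (y :- con 1ℚ)) :* q := y :* q)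
           ≈F-refl expX expY Q ⟩
    expY ⊛ Q                                                       ∎

  one⊕dy-P⊛Q : (one ⊕ ((expX-1 ⊛ expY) ⊛ Q)) ≈F (expX ⊛ Q)
  one⊕dy-P⊛Q = begin
    one ⊕ ((expX-1 ⊛ expY) ⊛ Q)                                    ≈⟨ ⊕-cong one-≈ (λ _ _ → refl) ⟩
    (Q ⊕ negF ((expX-1 ⊛ expY-1) ⊛ Q)) ⊕ ((expX-1 ⊛ expY) ⊛ Q)
      ≈⟨ solve 3 (λ x y q → (q :- ((x :- con 1ℚ) :* (y :- con 1ℚ)) :* q) :+ ((x :- con 1ℚ) :* y) :* q := x :* q)
           ≈F-refl expX expY Q ⟩
    expX ⊛ Q                                                       ∎

  dx-expX⊛Q : dx (expX ⊛ Q) ≈F rhsG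
  dx-expX⊛Q = begin
    dx (expX ⊛ Q)                                              ≈⟨ d-⊛ expX Q ⟩
    (dx expX ⊛ Q) ⊕ (expX ⊛ dx Q)                              ≈⟨ ⊕-cong (⊛-congʳ Q dx-expX) (⊛-congˡ expX dx-Q) ⟩
    (expX ⊛ Q) ⊕ (expX ⊛ (Q ⊛ ((expX ⊛ expY-1) ⊛ Q)))
      ≈⟨ solve 3 (λ x q r → x :* q :+ x :* (q :* (r :* q)) := (x :* q) :* (con 1ℚ :+ r :* q)) ≈F-refl expX Q (expX ⊛ expY-1) ⟩
    (expX ⊛ Q) ⊛ (one ⊕ ((expX ⊛ expY-1) ⊛ Q))                 ≈⟨ ⊛-congˡ (expX ⊛ Q) one⊕dx-P⊛Q ⟩
    (expX ⊛ Q) ⊛ (expY ⊛ Q)                                    ≈⟨ ≈F-sym rhsG-factor ⟩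
    rhsG                                                       ∎
    where open IsDerivation dx-isDerivation

  dy-expY⊛Q : dy (expY ⊛ Q) ≈F rhsG
  dy-expY⊛Q = begin
    dy (expY ⊛ Q)                                              ≈⟨ d-⊛ expY Q ⟩
    (dy expY ⊛ Q) ⊕ (expY ⊛ dy Q)                              ≈⟨ ⊕-cong (⊛-congʳ Q dy-expY) (⊛-congˡ expY dy-Q) ⟩
    (expY ⊛ Q) ⊕ (expY ⊛ (Q ⊛ ((expX-1 ⊛ expY) ⊛ Q)))
      ≈⟨ solve 3 (λ y q r → y :* q :+ y :* (q :* (r :* q)) := (y :* q) :* (con 1ℚ :+ r :* q)) ≈F-refl expY Q (expX-1 ⊛ expY) ⟩
    (expY ⊛ Q) ⊛ (one ⊕ ((expX-1 ⊛ expY) ⊛ Q))                 ≈⟨ ⊛-congˡ (expY ⊛ Q) one⊕dy-P⊛Q ⟩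
    (expY ⊛ Q) ⊛ (expX ⊛ Q)                                    ≈⟨ ⊛-comm (expY ⊛ Q) (expX ⊛ Q) ⟩
    (expX ⊛ Q) ⊛ (expY ⊛ Q)                                    ≈⟨ ≈F-sym rhsG-factor ⟩
    rhsG                                                       ∎
    where open IsDerivation dy-isDerivation

  dy-dx-rhsH : dy (dx rhsH) ≈F rhsG
  dy-dx-rhsH = begin
    dy (dx rhsH)                                               ≈⟨ d-cong dx-negLogOneMinus ⟩
    dy (Q ⊛ dx P)                                              ≈⟨ d-⊛ Q (dx P) ⟩
    (dy Q ⊛ dx P) ⊕ (Q ⊛ dy (dx P))                            ≈⟨ ⊕-cong (⊛-cong dy-Q dx-P) (⊛-congˡ Q dy-dx-P) ⟩
    ((Q ⊛ ((expX-1 ⊛ expY) ⊛ Q)) ⊛ (expX ⊛ expY-1)) ⊕ (Q ⊛ (expX ⊛ expY))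
      ≈⟨ solve 3 (λ x y q → (q :* (((x :- con 1ℚ) :* y) :* q)) :* (x :* (y :- con 1ℚ)) :+ q :* (x :* y)
                            := (q :* (x :* y)) :* (con 1ℚ :+ ((x :- con 1ℚ) :* (y :- con 1ℚ)) :* q)) ≈F-refl expX expY Q ⟩
    (Q ⊛ (expX ⊛ expY)) ⊛ (one ⊕ ((expX-1 ⊛ expY-1) ⊛ Q))      ≈⟨ ⊛-congˡ (Q ⊛ (expX ⊛ expY)) (≈F-sym Q-≈) ⟩
    (Q ⊛ (expX ⊛ expY)) ⊛ Q                                    ≈⟨ solve 3 (λ x y q → (q :* (x :* y)) :* q := (x :* q) :* (y :* q)) ≈F-refl expX expY Q ⟩
    (expX ⊛ Q) ⊛ (expY ⊛ Q)                                    ≈⟨ ≈F-sym rhsG-factor ⟩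
    rhsG                                                       ∎
    where open IsDerivation dy-isDerivation

  expX⊛Q-x⁰ : ∀ b → (expX ⊛ Q) 0 b ≡ oneF 0 b
  expX⊛Q-x⁰ b =
    trans (sumTo-single b _ (λ { (suc j) _ → *-zeroˡ (Q 0 (b ∸ suc j)) }))
          (trans (*-identityˡ (Q 0 b)) (invOneMinus-x⁰ b))

  expY⊛Q-y⁰ : ∀ a → (expY ⊛ Q) a 0 ≡ oneF a 0
  expY⊛Q-y⁰ a =
    trans (sumTo-single a _ (λ { (suc i) _ → *-zeroˡ (Q (a ∸ suc i) 0) }))
          (trans (*-identityˡ (Q a 0)) (invOneMinus-y⁰ a))

module LabelCounts where

  open import Defs
  open import Data.Bool using (Bool; true; false; not; _∧_; T)
  open import Data.Bool.Properties using (T-∧)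
  open import Data.Nat as ℕ using (ℕ; zero; suc; _+_; _*_; _∸_; _≤_; z≤n; s≤s; _≡ᵇ_)
  import Data.Nat.Properties as ℕₚ
  open import Data.List using (List; []; _∷_; _++_; length)
  open import Data.Vec as Vec using (Vec; []; _∷_)
  open import Data.Product using (_×_; _,_; proj₁; proj₂)
  open import Data.Empty using (⊥-elim)
  open import Data.Unit using (tt)
  open import Function.Bundles using (Equivalence)
  open import Relation.Binary.PropositionalEquality
  open import Relation.Nullary using (¬_; yes; no)

  ∧-split : ∀ a b → T (a ∧ b) → T a × T b
  ∧-split a b = Equivalence.to (T-∧ {a} {b})

  ∧-join : ∀ a b → T a → T b → T (a ∧ b)
  ∧-join a b p q = Equivalence.from (T-∧ {a} {b}) (p , q)

  boolToℕ : Bool → ℕ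
  boolToℕ true  = 1
  boolToℕ false = 0

  isSucᵇ : ℕ → Bool
  isSucᵇ zero    = false
  isSucᵇ (suc _) = true

  isSucᵇ-boolToℕ : ∀ b → isSucᵇ (boolToℕ b) ≡ b
  isSucᵇ-boolToℕ true  = refl
  isSucᵇ-boolToℕ false = refl

  countᵇ-here : ∀ x xs → countᵇ x (x ∷ xs) ≡ suc (countᵇ x xs)
  countᵇ-here x xs with x ≡ᵇ x in eq
  ... | true  = refl
  ... | false = ⊥-elim (subst T eq (ℕₚ.≡⇒≡ᵇ x x refl))

  countᵇ-there : ∀ i x xs → ¬ (i ≡ x) → countᵇ i (x ∷ xs) ≡ countᵇ i xs
  countᵇ-there i x xs i≢x with i ≡ᵇ x in eq
  ... | true  = ⊥-elim (i≢x (ℕₚ.≡ᵇ⇒≡ i x (subst T (sym eq) tt)))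
  ... | false = refl

  countᵇ-≤-∷ : ∀ i x xs → countᵇ i xs ≤ countᵇ i (x ∷ xs)
  countᵇ-≤-∷ i x xs with i ℕₚ.≟ x
  ... | yes refl = subst (countᵇ i xs ≤_) (sym (countᵇ-here i xs)) (ℕₚ.n≤1+n _)
  ... | no i≢x   = ℕₚ.≤-reflexive (sym (countᵇ-there i x xs i≢x))

  countᵇ-++ : ∀ i xs ys → countᵇ i (xs ++ ys) ≡ countᵇ i xs + countᵇ i ys
  countᵇ-++ i []       ys = refl
  countᵇ-++ i (x ∷ xs) ys with i ≡ᵇ x
  ... | true  = cong suc (countᵇ-++ i xs ys)
  ... | false = countᵇ-++ i xs ys

  -- sublists of X are encoded by boolean masks of length |X|
  select : (X : List ℕ) → Vec Bool (length X) → List ℕ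
  select []      []          = []
  select (x ∷ X) (true ∷ w)  = x ∷ select X w
  select (x ∷ X) (false ∷ w) = select X w

  complement : ∀ {n} → Vec Bool n → Vec Bool n
  complement = Vec.map not

  #true : ∀ {n} → Vec Bool n → ℕ
  #true []          = 0
  #true (true ∷ w)  = suc (#true w)
  #true (false ∷ w) = #true w

  occurrenceMask : (X : List ℕ) → List ℕ → Vec Bool (length X)
  occurrenceMask X xs = Vec.map (λ z → isSucᵇ (countᵇ z xs)) (Vec.fromList X)

  countᵇ-select-here : ∀ z X w b → countᵇ z (select (z ∷ X) (b ∷ w)) ≡ boolToℕ b + countᵇ z (select X w)
  countᵇ-select-here z X w true  = countᵇ-here z (select X w)
  countᵇ-select-here z X w false = refl

  countᵇ-select-there : ∀ i z X w b → ¬ (i ≡ z) → countᵇ i (select (z ∷ X) (b ∷ w)) ≡ countᵇ i (select X w)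
  countᵇ-select-there i z X w true  i≢z = countᵇ-there i z (select X w) i≢z
  countᵇ-select-there i z X w false i≢z = refl

  countᵇ-select-complement : ∀ i X w → countᵇ i (select X w) + countᵇ i (select X (complement w)) ≡ countᵇ i X
  countᵇ-select-complement i []      []      = refl
  countᵇ-select-complement i (x ∷ X) (b ∷ w) with i ℕₚ.≟ x
  ... | yes refl = begin
    countᵇ i (select (i ∷ X) (b ∷ w)) + countᵇ i (select (i ∷ X) (not b ∷ complement w))
      ≡⟨ cong₂ _+_ (countᵇ-select-here i X w b) (countᵇ-select-here i X (complement w) (not b)) ⟩
    (boolToℕ b + countᵇ i (select X w)) + (boolToℕ (not b) + countᵇ i (select X (complement w)))
      ≡⟨ one-side b (countᵇ i (select X w)) _ ⟩
    suc (countᵇ i (select X w) + countᵇ i (select X (complement w)))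
      ≡⟨ cong suc (countᵇ-select-complement i X w) ⟩
    suc (countᵇ i X)
      ≡⟨ countᵇ-here i X ⟨
    countᵇ i (i ∷ X)
      ∎
    where
    open ≡-Reasoning
    one-side : ∀ b m n → (boolToℕ b + m) + (boolToℕ (not b) + n) ≡ suc (m + n)
    one-side true  m n = refl
    one-side false m n = ℕₚ.+-suc m n
  ... | no i≢x = begin
    countᵇ i (select (x ∷ X) (b ∷ w)) + countᵇ i (select (x ∷ X) (not b ∷ complement w))
      ≡⟨ cong₂ _+_ (countᵇ-select-there i x X w b i≢x) (countᵇ-select-there i x X (complement w) (not b) i≢x) ⟩
    countᵇ i (select X w) + countᵇ i (select X (complement w))
      ≡⟨ countᵇ-select-complement i X w ⟩
    countᵇ i X
      ≡⟨ countᵇ-there i x X i≢x ⟨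
    countᵇ i (x ∷ X)
      ∎
    where open ≡-Reasoning

  countᵇ-select-≤ : ∀ i X w → countᵇ i (select X w) ≤ countᵇ i X
  countᵇ-select-≤ i X w = subst (countᵇ i (select X w) ≤_) (countᵇ-select-complement i X w) (ℕₚ.m≤m+n _ _)

  countᵇ-select-mask : ∀ (p : ℕ → Bool) i X → countᵇ i (select X (Vec.map p (Vec.fromList X))) ≡ countᵇ i X * boolToℕ (p i)
  countᵇ-select-mask p i [] = refl
  countᵇ-select-mask p i (z ∷ X) with i ℕₚ.≟ z
  ... | yes refl = trans (countᵇ-select-here i X _ (p i))
                         (trans (cong (boolToℕ (p i) +_) (countᵇ-select-mask p i X)) (cong (_* boolToℕ (p i)) (sym (countᵇ-here i X))))
  ... | no i≢z   = trans (countᵇ-select-there i z X _ (p z) i≢z)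
                         (trans (countᵇ-select-mask p i X) (cong (_* boolToℕ (p i)) (sym (countᵇ-there i z X i≢z))))

  complement-map : ∀ (p : ℕ → Bool) X → complement (Vec.map p (Vec.fromList X)) ≡ Vec.map (λ z → not (p z)) (Vec.fromList X)
  complement-map p []      = refl
  complement-map p (z ∷ X) = cong (not (p z) ∷_) (complement-map p X)

  length-select : ∀ X w → length (select X w) ≡ #true w
  length-select []      []          = refl
  length-select (x ∷ X) (true ∷ w)  = cong suc (length-select X w)
  length-select (x ∷ X) (false ∷ w) = length-select X w

  length-select-≤ : ∀ X w → length (select X w) ≤ length X
  length-select-≤ []      []          = z≤n
  length-select-≤ (x ∷ X) (true ∷ w)  = s≤s (length-select-≤ X w)
  length-select-≤ (x ∷ X) (false ∷ w) = ℕₚ.m≤n⇒m≤1+n (length-select-≤ X w)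

  length-select-complement : ∀ X w → length (select X (complement w)) ≡ length X ∸ #true w
  length-select-complement X w =
    trans (sym (ℕₚ.m+n∸m≡n (length (select X w)) _)) (cong₂ _∸_ (length-partition X w) (length-select X w))
    where
    length-partition : ∀ X w → length (select X w) + length (select X (complement w)) ≡ length X
    length-partition []      []          = refl
    length-partition (x ∷ X) (true ∷ w)  = cong suc (length-partition X w)
    length-partition (x ∷ X) (false ∷ w) = trans (ℕₚ.+-suc _ _) (cong suc (length-partition X w))

  SameCounts : List ℕ → List ℕ → Set
  SameCounts X zs = ∀ x → countᵇ x zs ≡ countᵇ x X

  Distinct : List ℕ → Set
  Distinct X = ∀ x → countᵇ x X ≤ 1

  Distinct-tail : ∀ z X → Distinct (z ∷ X) → Distinct X
  Distinct-tail z X zX-distinct x = ℕₚ.≤-trans (countᵇ-≤-∷ x z X) (zX-distinct x)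

  Distinct-head : ∀ z X → Distinct (z ∷ X) → countᵇ z X ≡ 0
  Distinct-head z X zX-distinct with countᵇ z X | subst (_≤ 1) (countᵇ-here z X) (zX-distinct z)
  ... | zero  | _      = refl
  ... | suc _ | s≤s ()

  Distinct-select : ∀ X w → Distinct X → Distinct (select X w)
  Distinct-select X w X-distinct x = ℕₚ.≤-trans (countᵇ-select-≤ x X w) (X-distinct x)

  split-≤1 : ∀ m n t → m + n ≡ t → t ≤ 1 → (m ≡ t * boolToℕ (isSucᵇ m)) × (n ≡ t * boolToℕ (not (isSucᵇ m)))
  split-≤1 zero          n       .n                     refl _        = sym (ℕₚ.*-zeroʳ n) , sym (ℕₚ.*-identityʳ n)
  split-≤1 (suc zero)    zero    .1                     refl _        = refl , refl
  split-≤1 (suc zero)    (suc n) .(suc (suc n))         refl (s≤s ())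
  split-≤1 (suc (suc m)) n       .(suc (suc (m + n)))   refl (s≤s ())

  SameCounts-++⁻ : ∀ X xs ys → Distinct X → SameCounts X (xs ++ ys) →
                   SameCounts (select X (occurrenceMask X xs)) xs × SameCounts (select X (complement (occurrenceMask X xs))) ys
  SameCounts-++⁻ X xs ys X-distinct X≈xs++ys =
    (λ x → trans (proj₁ (split x)) (sym (countᵇ-select-mask occurs x X))) ,
    (λ x → trans (proj₂ (split x)) (sym (trans (cong (λ w → countᵇ x (select X w)) (complement-map occurs X))
                                               (countᵇ-select-mask (λ z → not (occurs z)) x X))))
    where
    occurs : ℕ → Bool
    occurs z = isSucᵇ (countᵇ z xs)
    split : ∀ x → (countᵇ x xs ≡ countᵇ x X * boolToℕ (occurs x)) × (countᵇ x ys ≡ countᵇ x X * boolToℕ (not (occurs x)))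
    split x = split-≤1 (countᵇ x xs) (countᵇ x ys) (countᵇ x X) (trans (sym (countᵇ-++ x xs ys)) (X≈xs++ys x)) (X-distinct x)

  SameCounts-++⁺ : ∀ X w xs ys → SameCounts (select X w) xs → SameCounts (select X (complement w)) ys → SameCounts X (xs ++ ys)
  SameCounts-++⁺ X w xs ys X₁≈xs X₂≈ys x =
    trans (countᵇ-++ x xs ys) (trans (cong₂ _+_ (X₁≈xs x) (X₂≈ys x)) (countᵇ-select-complement x X w))

  1≤countᵇ-here : ∀ z X → 1 ≤ countᵇ z (z ∷ X)
  1≤countᵇ-here z X = subst (1 ≤_) (sym (countᵇ-here z X)) (s≤s z≤n)

  occurrenceMask-select : ∀ X w xs → Distinct X → (∀ x → 1 ≤ countᵇ x X → countᵇ x xs ≡ countᵇ x (select X w)) →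
                          occurrenceMask X xs ≡ w
  occurrenceMask-select []      []      xs _           _         = refl
  occurrenceMask-select (z ∷ X) (b ∷ w) xs zX-distinct xs≈selected =
    cong₂ _∷_ head-bit (occurrenceMask-select X w xs (Distinct-tail z X zX-distinct) xs≈selected′)
    where
    z∉select : countᵇ z (select X w) ≡ 0
    z∉select = ℕₚ.n≤0⇒n≡0 (subst (countᵇ z (select X w) ≤_) (Distinct-head z X zX-distinct) (countᵇ-select-≤ z X w))
    head-bit : isSucᵇ (countᵇ z xs) ≡ b
    head-bit = begin
      isSucᵇ (countᵇ z xs)                              ≡⟨ cong isSucᵇ (xs≈selected z (1≤countᵇ-here z X)) ⟩
      isSucᵇ (countᵇ z (select (z ∷ X) (b ∷ w)))        ≡⟨ cong isSucᵇ (countᵇ-select-here z X w b) ⟩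
      isSucᵇ (boolToℕ b + countᵇ z (select X w))        ≡⟨ cong (λ n → isSucᵇ (boolToℕ b + n)) z∉select ⟩
      isSucᵇ (boolToℕ b + 0)                            ≡⟨ cong isSucᵇ (ℕₚ.+-identityʳ (boolToℕ b)) ⟩
      isSucᵇ (boolToℕ b)                                ≡⟨ isSucᵇ-boolToℕ b ⟩
      b                                                 ∎
      where open ≡-Reasoning
    xs≈selected′ : ∀ x → 1 ≤ countᵇ x X → countᵇ x xs ≡ countᵇ x (select X w)
    xs≈selected′ x 1≤count with x ℕₚ.≟ z
    ... | yes refl = ⊥-elim (ℕₚ.<-irrefl refl (ℕₚ.<-≤-trans (s≤s z≤n) (subst (1 ≤_) (Distinct-head x X zX-distinct) 1≤count)))
    ... | no x≢z   = trans (xs≈selected x (subst (1 ≤_) (sym (countᵇ-there x z X x≢z)) 1≤count)) (countᵇ-select-there x z X w b x≢z)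

  remove : ℕ → List ℕ → List ℕ
  remove y []       = []
  remove y (x ∷ xs) with y ≡ᵇ x
  ... | true  = xs
  ... | false = x ∷ remove y xs

  remove-here : ∀ y xs → remove y (y ∷ xs) ≡ xs
  remove-here y xs with y ≡ᵇ y in eq
  ... | true  = refl
  ... | false = ⊥-elim (subst T eq (ℕₚ.≡⇒≡ᵇ y y refl))

  remove-there : ∀ y x xs → ¬ (y ≡ x) → remove y (x ∷ xs) ≡ x ∷ remove y xs
  remove-there y x xs y≢x with y ≡ᵇ x in eq
  ... | true  = ⊥-elim (y≢x (ℕₚ.≡ᵇ⇒≡ y x (subst T (sym eq) tt)))
  ... | false = refl

  length-remove : ∀ y xs → 1 ≤ countᵇ y xs → length xs ≡ suc (length (remove y xs))
  length-remove y (x ∷ xs) y∈ with y ℕₚ.≟ x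
  ... | yes refl = cong suc (cong length (sym (remove-here y xs)))
  ... | no y≢x   = trans (cong suc (length-remove y xs (subst (1 ≤_) (countᵇ-there y x xs y≢x) y∈)))
                         (cong (λ l → suc (length l)) (sym (remove-there y x xs y≢x)))

  countᵇ-remove-same : ∀ y xs → 1 ≤ countᵇ y xs → countᵇ y xs ≡ suc (countᵇ y (remove y xs))
  countᵇ-remove-same y (x ∷ xs) y∈ with y ℕₚ.≟ x
  ... | yes refl = trans (countᵇ-here y xs) (cong (λ l → suc (countᵇ y l)) (sym (remove-here y xs)))
  ... | no y≢x   = begin
    countᵇ y (x ∷ xs)                      ≡⟨ countᵇ-there y x xs y≢x ⟩
    countᵇ y xs                            ≡⟨ countᵇ-remove-same y xs (subst (1 ≤_) (countᵇ-there y x xs y≢x) y∈) ⟩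
    suc (countᵇ y (remove y xs))           ≡⟨ cong suc (countᵇ-there y x (remove y xs) y≢x) ⟨
    suc (countᵇ y (x ∷ remove y xs))       ≡⟨ cong (λ l → suc (countᵇ y l)) (remove-there y x xs y≢x) ⟨
    suc (countᵇ y (remove y (x ∷ xs)))     ∎
    where open ≡-Reasoning

  countᵇ-remove-other : ∀ y i xs → ¬ (i ≡ y) → countᵇ i (remove y xs) ≡ countᵇ i xs
  countᵇ-remove-other y i []       i≢y = refl
  countᵇ-remove-other y i (x ∷ xs) i≢y with y ℕₚ.≟ x
  ... | yes refl = trans (cong (countᵇ i) (remove-here y xs)) (sym (countᵇ-there i y xs i≢y))
  ... | no y≢x with i ℕₚ.≟ x
  ...   | yes refl = trans (cong (countᵇ i) (remove-there y i xs y≢x))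
                           (trans (countᵇ-here i (remove y xs)) (trans (cong suc (countᵇ-remove-other y i xs i≢y)) (sym (countᵇ-here i xs))))
  ...   | no i≢x   = trans (cong (countᵇ i) (remove-there y x xs y≢x))
                           (trans (countᵇ-there i x (remove y xs) i≢x) (trans (countᵇ-remove-other y i xs i≢y) (sym (countᵇ-there i x xs i≢x))))

  SameCounts-length : ∀ zs X → SameCounts X zs → length zs ≡ length X
  SameCounts-length []       []      _     = refl
  SameCounts-length []       (x ∷ X) X≈[]  = ⊥-elim (ℕₚ.0≢1+n (trans (X≈[] x) (countᵇ-here x X)))
  SameCounts-length (y ∷ zs) X       X≈yzs =
    trans (cong suc (SameCounts-length zs (remove y X) X−y≈zs)) (sym (length-remove y X y∈X))
    where
    y∈X : 1 ≤ countᵇ y X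
    y∈X = subst (1 ≤_) (trans (sym (countᵇ-here y zs)) (X≈yzs y)) (s≤s z≤n)
    X−y≈zs : SameCounts (remove y X) zs
    X−y≈zs x with x ℕₚ.≟ y
    ... | yes refl = ℕₚ.suc-injective (trans (sym (countᵇ-here x zs)) (trans (X≈yzs x) (countᵇ-remove-same x X y∈X)))
    ... | no x≢y   = trans (sym (countᵇ-there x y zs x≢y)) (trans (X≈yzs x) (sym (countᵇ-remove-other y x X x≢y)))

  isPermᵇ : List ℕ → List ℕ → Bool
  isPermᵇ X zs = (length zs ≡ᵇ length X) ∧ allᵇ (λ x → countᵇ x zs ≡ᵇ 1) X

  allᵇ-intro : ∀ (p : ℕ → Bool) X → (∀ x → 1 ≤ countᵇ x X → T (p x)) → T (allᵇ p X)
  allᵇ-intro p [] h = tt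
  allᵇ-intro p (z ∷ X) h = ∧-join (p z) (allᵇ p X) (h z (1≤countᵇ-here z X))
    (allᵇ-intro p X (λ x 1≤count → h x (ℕₚ.≤-trans 1≤count (countᵇ-≤-∷ x z X))))

  allᵇ-elim : ∀ (p : ℕ → Bool) X → T (allᵇ p X) → ∀ x → 1 ≤ countᵇ x X → T (p x)
  allᵇ-elim p [] t x ()
  allᵇ-elim p (z ∷ X) t x x∈ with x ℕₚ.≟ z
  ... | yes refl = proj₁ (∧-split (p x) (allᵇ p X) t)
  ... | no x≢z   = allᵇ-elim p X (proj₂ (∧-split (p z) (allᵇ p X) t)) x (subst (1 ≤_) (countᵇ-there x z X x≢z) x∈)

  1≤n≤1⇒n≡1 : ∀ {n} → 1 ≤ n → n ≤ 1 → n ≡ 1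
  1≤n≤1⇒n≡1 (s≤s z≤n) (s≤s z≤n) = refl

  SameCounts⇒isPermᵇ : ∀ X zs → Distinct X → SameCounts X zs → T (isPermᵇ X zs)
  SameCounts⇒isPermᵇ X zs X-distinct X≈zs = ∧-join (length zs ≡ᵇ length X) (allᵇ (λ x → countᵇ x zs ≡ᵇ 1) X)
    (ℕₚ.≡⇒≡ᵇ _ _ (SameCounts-length zs X X≈zs))
    (allᵇ-intro _ X (λ x x∈ → ℕₚ.≡⇒≡ᵇ _ _ (trans (X≈zs x) (1≤n≤1⇒n≡1 x∈ (X-distinct x)))))

  isPermᵇ⇒SameCounts : ∀ X zs → Distinct X → T (isPermᵇ X zs) → SameCounts X zs
  isPermᵇ⇒SameCounts X zs X-distinct X≈zs =
    go X zs X-distinct (ℕₚ.≡ᵇ⇒≡ _ _ (proj₁ parts)) (λ x 1≤count → ℕₚ.≡ᵇ⇒≡ _ _ (allᵇ-elim _ X (proj₂ parts) x 1≤count))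
    where
    parts = ∧-split (length zs ≡ᵇ length X) (allᵇ (λ x → countᵇ x zs ≡ᵇ 1) X) X≈zs
    go : ∀ X zs → Distinct X → length zs ≡ length X → (∀ x → 1 ≤ countᵇ x X → countᵇ x zs ≡ 1) → SameCounts X zs
    go []      []  _           _      _           x = refl
    go (z ∷ X) zs zX-distinct |zs|≡ once x with x ℕₚ.≟ z
    ... | yes refl = trans (once x (1≤countᵇ-here x X))
                           (trans (cong suc (sym (Distinct-head x X zX-distinct))) (sym (countᵇ-here x X)))
    ... | no x≢z   = trans (sym (countᵇ-remove-other z x zs x≢z)) (trans (X≈zs−z x) (sym (countᵇ-there x z X x≢z)))
      where
      z∈zs : 1 ≤ countᵇ z zs
      z∈zs = subst (1 ≤_) (sym (once z (1≤countᵇ-here z X))) (s≤s z≤n)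
      once′ : ∀ y → 1 ≤ countᵇ y X → countᵇ y (remove z zs) ≡ 1
      once′ y 1≤count with y ℕₚ.≟ z
      ... | yes refl = ⊥-elim (ℕₚ.<-irrefl refl (ℕₚ.<-≤-trans (s≤s z≤n) (subst (1 ≤_) (Distinct-head y X zX-distinct) 1≤count)))
      ... | no y≢z   = trans (countᵇ-remove-other z y zs y≢z) (once y (subst (1 ≤_) (sym (countᵇ-there y z X y≢z)) 1≤count))
      X≈zs−z : SameCounts X (remove z zs)
      X≈zs−z = go X (remove z zs) (Distinct-tail z X zX-distinct)
                  (ℕₚ.suc-injective (trans (sym (length-remove z zs z∈zs)) |zs|≡)) once′

  isPermᵇ-++⁻ : ∀ X xs ys → Distinct X → T (isPermᵇ X (xs ++ ys)) →
                T (isPermᵇ (select X (occurrenceMask X xs)) xs) × T (isPermᵇ (select X (complement (occurrenceMask X xs))) ys)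
  isPermᵇ-++⁻ X xs ys X-distinct X≈xs++ys =
    SameCounts⇒isPermᵇ (select X w) xs (Distinct-select X w X-distinct) (proj₁ split) ,
    SameCounts⇒isPermᵇ (select X (complement w)) ys (Distinct-select X (complement w) X-distinct) (proj₂ split)
    where
    w = occurrenceMask X xs
    split = SameCounts-++⁻ X xs ys X-distinct (isPermᵇ⇒SameCounts X (xs ++ ys) X-distinct X≈xs++ys)

  isPermᵇ-++⁺ : ∀ X w xs ys → Distinct X → T (isPermᵇ (select X w) xs) → T (isPermᵇ (select X (complement w)) ys) →
                T (isPermᵇ X (xs ++ ys))
  isPermᵇ-++⁺ X w xs ys X-distinct X₁≈xs X₂≈ys = SameCounts⇒isPermᵇ X (xs ++ ys) X-distinct
    (SameCounts-++⁺ X w xs ys (isPermᵇ⇒SameCounts (select X w) xs (Distinct-select X w X-distinct) X₁≈xs)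
                              (isPermᵇ⇒SameCounts (select X (complement w)) ys (Distinct-select X (complement w) X-distinct) X₂≈ys))

  occurrenceMask-isPermᵇ : ∀ X w xs → Distinct X → T (isPermᵇ (select X w) xs) → occurrenceMask X xs ≡ w
  occurrenceMask-isPermᵇ X w xs X-distinct Xw≈xs = occurrenceMask-select X w xs X-distinct
    (λ x _ → isPermᵇ⇒SameCounts (select X w) xs (Distinct-select X w X-distinct) Xw≈xs x)

module Branches where

  open import Defs
  open LabelCounts
  open import Data.Bool using (Bool; true; false; T)
  open import Data.Bool.Properties using (T-irrelevant)
  open import Data.Nat as ℕ using (ℕ; zero; suc; _≤_; _<_; z≤n; s≤s; _<ᵇ_)
  import Data.Nat.Properties as ℕₚ
  open import Data.List using (List; []; _∷_; length)
  open import Data.Vec using (Vec; []; _∷_)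
  open import Data.Maybe using (Maybe; just; nothing)
  open import Data.Product using (Σ; _×_; _,_; proj₁; proj₂)
  open import Data.Empty using (⊥; ⊥-elim)
  open import Data.Unit using (⊤; tt)
  open import Relation.Binary.PropositionalEquality
  open import Relation.Nullary using (yes; no)
  open import Function.Bundles using (_↔_; mk↔ₛ′)

  Decreasing : List ℕ → Set
  Decreasing []      = ⊤
  Decreasing (x ∷ X) = (∀ y → 1 ≤ countᵇ y X → y < x) × Decreasing X

  Decreasing⇒Distinct : ∀ X → Decreasing X → Distinct X
  Decreasing⇒Distinct []      _                x = z≤n
  Decreasing⇒Distinct (z ∷ X) (z-max , X-decr) x with x ℕₚ.≟ z
  ... | yes refl = subst (_≤ 1) (sym (countᵇ-here x X)) (s≤s (ℕₚ.≤-reflexive x∉X))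
    where
    x∉X : countᵇ x X ≡ 0
    x∉X with countᵇ x X in eq
    ... | zero  = refl
    ... | suc _ = ⊥-elim (ℕₚ.<-irrefl refl (z-max x (subst (1 ≤_) (sym eq) (s≤s z≤n))))
  ... | no x≢z = subst (_≤ 1) (sym (countᵇ-there x z X x≢z)) (Decreasing⇒Distinct X X-decr x)

  Decreasing-select : ∀ X w → Decreasing X → Decreasing (select X w)
  Decreasing-select []      []          _                = tt
  Decreasing-select (x ∷ X) (true ∷ w)  (x-max , X-decr) =
    (λ y 1≤count → x-max y (ℕₚ.≤-trans 1≤count (countᵇ-select-≤ y X w))) , Decreasing-select X w X-decr
  Decreasing-select (x ∷ X) (false ∷ w) (_ , X-decr)     = Decreasing-select X w X-decr

  Valid : Bool → Bool → Bool → Bool → Set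
  Valid a b c d = T a × T b × T c × T d

  Valid-irrelevant : ∀ {a b c d} (p q : Valid a b c d) → p ≡ q
  Valid-irrelevant (p₁ , p₂ , p₃ , p₄) (q₁ , q₂ , q₃ , q₄) =
    cong₂ _,_ (T-irrelevant p₁ q₁) (cong₂ _,_ (T-irrelevant p₂ q₂) (cong₂ _,_ (T-irrelevant p₃ q₃) (T-irrelevant p₄ q₄)))

  Σ-Valid-≡ : ∀ {A : Set} {a b c d : A → Bool} {x y : A} {p q} → x ≡ y →
              _≡_ {A = Σ A (λ z → Valid (a z) (b z) (c z) (d z))} (x , p) (y , q)
  Σ-Valid-≡ refl = cong (_ ,_) (Valid-irrelevant _ _)

  -- NATs on arbitrary distinct labels: the left labels rearrange X and the right labels rearrange Y
  ValidTree : List ℕ → List ℕ → LTree → Set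
  ValidTree X Y t = Valid (isPermᵇ X (leftLabels t)) (isPermᵇ Y (rightLabels t)) (leftDecr t) (rightDecr t)

  NATOn : List ℕ → List ℕ → Set
  NATOn X Y = Σ LTree (ValidTree X Y)

  ValidLeft : List ℕ → List ℕ → Maybe (ℕ × LTree) → Set
  ValidLeft X Y l = Valid (isPermᵇ X (leftLabelsM l)) (isPermᵇ Y (rightLabelsL l)) (leftDecrL l) (rightDecrL l)

  LeftBranch : List ℕ → List ℕ → Set
  LeftBranch X Y = Σ (Maybe (ℕ × LTree)) (ValidLeft X Y)

  ValidRight : List ℕ → List ℕ → Maybe (ℕ × LTree) → Set
  ValidRight X Y r = Valid (isPermᵇ X (leftLabelsR r)) (isPermᵇ Y (rightLabelsM r)) (leftDecrR r) (rightDecrR r)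

  RightBranch : List ℕ → List ℕ → Set
  RightBranch X Y = Σ (Maybe (ℕ × LTree)) (ValidRight X Y)

  RootSplit : List ℕ → List ℕ → Set
  RootSplit X Y = Σ (Vec Bool (length X)) λ w → Σ (Vec Bool (length Y)) λ v →
    LeftBranch (select X w) (select Y v) × RightBranch (select X (complement w)) (select Y (complement v))

  module RootDecomposition (X Y : List ℕ) (X-distinct : Distinct X) (Y-distinct : Distinct Y) where

    to : NATOn X Y → RootSplit X Y
    to (node l r , X≈ , Y≈ , decrL , decrR) =
      occurrenceMask X (leftLabelsM l) , occurrenceMask Y (rightLabelsL l) ,
      (l , proj₁ X-split , proj₁ Y-split , proj₁ L-split , proj₁ R-split) ,
      (r , proj₂ X-split , proj₂ Y-split , proj₂ L-split , proj₂ R-split)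
      where
      X-split = isPermᵇ-++⁻ X (leftLabelsM l) (leftLabelsR r) X-distinct X≈
      Y-split = isPermᵇ-++⁻ Y (rightLabelsL l) (rightLabelsM r) Y-distinct Y≈
      L-split = ∧-split (leftDecrL l) (leftDecrR r) decrL
      R-split = ∧-split (rightDecrL l) (rightDecrR r) decrR

    from : RootSplit X Y → NATOn X Y
    from (w , v , (l , Xₗ≈ , Yₗ≈ , decrLₗ , decrRₗ) , (r , Xᵣ≈ , Yᵣ≈ , decrLᵣ , decrRᵣ)) =
      node l r ,
      isPermᵇ-++⁺ X w (leftLabelsM l) (leftLabelsR r) X-distinct Xₗ≈ Xᵣ≈ ,
      isPermᵇ-++⁺ Y v (rightLabelsL l) (rightLabelsM r) Y-distinct Yₗ≈ Yᵣ≈ ,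
      ∧-join (leftDecrL l) (leftDecrR r) decrLₗ decrLᵣ ,
      ∧-join (rightDecrL l) (rightDecrR r) decrRₗ decrRᵣ

    from∘to : ∀ t → from (to t) ≡ t
    from∘to (node l r , _) = Σ-Valid-≡ refl

    RootSplit-≡ : ∀ {w w' v v' l r pₗ pₗ' pᵣ pᵣ'} → w ≡ w' → v ≡ v' →
                  _≡_ {A = RootSplit X Y} (w , v , (l , pₗ) , (r , pᵣ)) (w' , v' , (l , pₗ') , (r , pᵣ'))
    RootSplit-≡ refl refl = cong₂ (λ L R → (_ , _ , L , R)) (Σ-Valid-≡ refl) (Σ-Valid-≡ refl)

    to∘from : ∀ s → to (from s) ≡ s
    to∘from (w , v , (l , Xₗ≈ , Yₗ≈ , _) , (r , _)) =
      RootSplit-≡ (occurrenceMask-isPermᵇ X w (leftLabelsM l) X-distinct Xₗ≈)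
                  (occurrenceMask-isPermᵇ Y v (rightLabelsL l) Y-distinct Yₗ≈)

    iso : NATOn X Y ↔ RootSplit X Y
    iso = mk↔ₛ′ to from to∘from from∘to

  -- the child's label exceeds every label below it, and h is the largest label of h ∷ X
  branch-label≡head : ∀ h X ℓ L → Decreasing (h ∷ X) → T (isPermᵇ (h ∷ X) (ℓ ∷ L)) → T (allᵇ (_<ᵇ ℓ) L) →
                      (ℓ ≡ h) × T (isPermᵇ X L)
  branch-label≡head h X ℓ L hX-decr@(h-max , X-decr) hX≈ℓL L<ℓ = ℓ≡h , SameCounts⇒isPermᵇ X L (Decreasing⇒Distinct X X-decr) X≈L
    where
    counts : SameCounts (h ∷ X) (ℓ ∷ L)
    counts = isPermᵇ⇒SameCounts (h ∷ X) (ℓ ∷ L) (Decreasing⇒Distinct (h ∷ X) hX-decr) hX≈ℓL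
    ℓ≡h : ℓ ≡ h
    ℓ≡h with ℓ ℕₚ.≟ h
    ... | yes ℓ≡h = ℓ≡h
    ... | no ℓ≢h = ⊥-elim (ℕₚ.<-asym ℓ<h h<ℓ)
      where
      ℓ<h : ℓ < h
      ℓ<h = h-max ℓ (subst (1 ≤_) (trans (sym (countᵇ-here ℓ L)) (trans (counts ℓ) (countᵇ-there ℓ h X ℓ≢h))) (s≤s z≤n))
      h<ℓ : h < ℓ
      h<ℓ = ℕₚ.<ᵇ⇒< h ℓ (allᵇ-elim (_<ᵇ ℓ) L L<ℓ h
              (subst (1 ≤_) (trans (sym (countᵇ-here h X)) (trans (sym (counts h)) (countᵇ-there h ℓ L (λ h≡ℓ → ℓ≢h (sym h≡ℓ))))) (s≤s z≤n)))
    X≈L : SameCounts X L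
    X≈L x with x ℕₚ.≟ h
    ... | yes refl = ℕₚ.suc-injective (trans (sym (countᵇ-here x L)) (trans (cong (λ z → countᵇ x (z ∷ L)) (sym ℓ≡h))
                                                                               (trans (counts x) (countᵇ-here x X))))
    ... | no x≢h   = trans (sym (countᵇ-there x h L x≢h)) (trans (cong (λ z → countᵇ x (z ∷ L)) (sym ℓ≡h))
                                                                  (trans (counts x) (countᵇ-there x h X x≢h)))

  head-branch-valid : ∀ h X L → Decreasing (h ∷ X) → T (isPermᵇ X L) → T (isPermᵇ (h ∷ X) (h ∷ L)) × T (allᵇ (_<ᵇ h) L)
  head-branch-valid h X L hX-decr@(h-max , X-decr) X≈L =
    SameCounts⇒isPermᵇ (h ∷ X) (h ∷ L) (Decreasing⇒Distinct (h ∷ X) hX-decr) counts ,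
    allᵇ-intro (_<ᵇ h) L (λ y 1≤count → ℕₚ.<⇒<ᵇ (h-max y (subst (1 ≤_) (X≈L′ y) 1≤count)))
    where
    X≈L′ : SameCounts X L
    X≈L′ = isPermᵇ⇒SameCounts X L (Decreasing⇒Distinct X X-decr) X≈L
    counts : SameCounts (h ∷ X) (h ∷ L)
    counts x with x ℕₚ.≟ h
    ... | yes refl = trans (countᵇ-here x L) (trans (cong suc (X≈L′ x)) (sym (countᵇ-here x X)))
    ... | no x≢h   = trans (countᵇ-there x h L x≢h) (trans (X≈L′ x) (sym (countᵇ-there x h X x≢h)))

  module LeftBranchCons (h : ℕ) (X Y : List ℕ) (hX-decreasing : Decreasing (h ∷ X)) where

    to : LeftBranch (h ∷ X) Y → NATOn X Y
    to (just (ℓ , t) , hX≈ , Y≈ , decrL , decrR) =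
      t , proj₂ (branch-label≡head h X ℓ (leftLabels t) hX-decreasing hX≈ (proj₁ below-ℓ)) , Y≈ , proj₂ below-ℓ , decrR
      where below-ℓ = ∧-split (allᵇ (_<ᵇ ℓ) (leftLabels t)) (leftDecr t) decrL
    to (nothing , () , _)

    from : NATOn X Y → LeftBranch (h ∷ X) Y
    from (t , X≈ , Y≈ , decrL , decrR) =
      just (h , t) , proj₁ head-valid , Y≈ , ∧-join (allᵇ (_<ᵇ h) (leftLabels t)) (leftDecr t) (proj₂ head-valid) decrL , decrR
      where head-valid = head-branch-valid h X (leftLabels t) hX-decreasing X≈

    to∘from : ∀ t → to (from t) ≡ t
    to∘from _ = Σ-Valid-≡ refl

    from∘to : ∀ b → from (to b) ≡ b
    from∘to (just (ℓ , t) , hX≈ , _ , decrL , _) =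
      Σ-Valid-≡ (cong (λ k → just (k , t)) (sym (proj₁ (branch-label≡head h X ℓ (leftLabels t) hX-decreasing hX≈
                                                    (proj₁ (∧-split (allᵇ (_<ᵇ ℓ) (leftLabels t)) (leftDecr t) decrL))))))
    from∘to (nothing , () , _)

    iso : LeftBranch (h ∷ X) Y ↔ NATOn X Y
    iso = mk↔ₛ′ to from to∘from from∘to

  module RightBranchCons (h : ℕ) (X Y : List ℕ) (hY-decreasing : Decreasing (h ∷ Y)) where

    to : RightBranch X (h ∷ Y) → NATOn X Y
    to (just (ρ , t) , X≈ , hY≈ , decrL , decrR) =
      t , X≈ , proj₂ (branch-label≡head h Y ρ (rightLabels t) hY-decreasing hY≈ (proj₁ below-ρ)) , decrL , proj₂ below-ρ
      where below-ρ = ∧-split (allᵇ (_<ᵇ ρ) (rightLabels t)) (rightDecr t) decrR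
    to (nothing , _ , () , _)

    from : NATOn X Y → RightBranch X (h ∷ Y)
    from (t , X≈ , Y≈ , decrL , decrR) =
      just (h , t) , X≈ , proj₁ head-valid , decrL , ∧-join (allᵇ (_<ᵇ h) (rightLabels t)) (rightDecr t) (proj₂ head-valid) decrR
      where head-valid = head-branch-valid h Y (rightLabels t) hY-decreasing Y≈

    to∘from : ∀ t → to (from t) ≡ t
    to∘from _ = Σ-Valid-≡ refl

    from∘to : ∀ b → from (to b) ≡ b
    from∘to (just (ρ , t) , _ , hY≈ , _ , decrR) =
      Σ-Valid-≡ (cong (λ k → just (k , t)) (sym (proj₁ (branch-label≡head h Y ρ (rightLabels t) hY-decreasing hY≈
                                                    (proj₁ (∧-split (allᵇ (_<ᵇ ρ) (rightLabels t)) (rightDecr t) decrR))))))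
    from∘to (nothing , _ , () , _)

    iso : RightBranch X (h ∷ Y) ↔ NATOn X Y
    iso = mk↔ₛ′ to from to∘from from∘to

  LeftBranch-[]-[] : LeftBranch [] [] ↔ ⊤
  LeftBranch-[]-[] = mk↔ₛ′ _ (λ _ → nothing , _) (λ _ → refl) λ { (nothing , _) → refl ; (just _ , () , _) }

  LeftBranch-[]-∷ : ∀ y Y → LeftBranch [] (y ∷ Y) ↔ ⊥
  LeftBranch-[]-∷ y Y = mk↔ₛ′ empty (λ ()) (λ ()) (λ b → ⊥-elim (empty b))
    where
    empty : LeftBranch [] (y ∷ Y) → ⊥
    empty (nothing , _ , () , _)
    empty (just _ , () , _)

  RightBranch-[]-[] : RightBranch [] [] ↔ ⊤
  RightBranch-[]-[] = mk↔ₛ′ _ (λ _ → nothing , _) (λ _ → refl) λ { (nothing , _) → refl ; (just _ , _ , () , _) }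

  RightBranch-∷-[] : ∀ x X → RightBranch (x ∷ X) [] ↔ ⊥
  RightBranch-∷-[] x X = mk↔ₛ′ empty (λ ()) (λ ()) (λ b → ⊥-elim (empty b))
    where
    empty : RightBranch (x ∷ X) [] → ⊥
    empty (nothing , () , _)
    empty (just _ , _ , () , _)

module Enumeration where

  open import Defs
  open LabelCounts
  open Branches
  open import Data.Bool using (Bool; true; false)
  open import Data.Nat as ℕ using (ℕ; zero; suc; _+_; _*_; _∸_; _≤_; _<_; s≤s)
  import Data.Nat.Properties as ℕₚ
  open import Data.List using ([]; _∷_; length)
  open import Data.Vec using (Vec; []; _∷_)
  open import Data.Fin using (Fin)
  import Data.Fin.Properties as Finₚ
  open import Data.Product using (Σ; _,_; proj₂)
  open import Data.Sum using (_⊎_; inj₁; inj₂)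
  open import Relation.Binary.PropositionalEquality
  open import Function.Bundles using (_↔_; mk↔ₛ′)
  open import Function.Properties.Inverse using (↔-refl; ↔-sym; ↔-trans)
  open import Data.Sum.Function.Propositional using (_⊎-↔_)
  open import Data.Product.Function.NonDependent.Propositional using (_×-↔_)

  sumMasks : (n : ℕ) → (Vec Bool n → ℕ) → ℕ
  sumMasks zero    g = g []
  sumMasks (suc n) g = sumMasks n (λ w → g (true ∷ w)) + sumMasks n (λ w → g (false ∷ w))

  Σ-Vec-[]↔ : ∀ (F : Vec Bool 0 → Set) → Σ (Vec Bool 0) F ↔ F []
  Σ-Vec-[]↔ F = mk↔ₛ′ (λ { ([] , x) → x }) ([] ,_) (λ _ → refl) (λ { ([] , _) → refl })

  Σ-Vec-∷↔ : ∀ n (F : Vec Bool (suc n) → Set) →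
             Σ (Vec Bool (suc n)) F ↔ (Σ (Vec Bool n) (λ w → F (true ∷ w)) ⊎ Σ (Vec Bool n) (λ w → F (false ∷ w)))
  Σ-Vec-∷↔ n F = mk↔ₛ′ to from (λ { (inj₁ _) → refl ; (inj₂ _) → refl }) (λ { ((true ∷ _) , _) → refl ; ((false ∷ _) , _) → refl })
    where
    to : Σ (Vec Bool (suc n)) F → Σ (Vec Bool n) (λ w → F (true ∷ w)) ⊎ Σ (Vec Bool n) (λ w → F (false ∷ w))
    to ((true ∷ w) , x)  = inj₁ (w , x)
    to ((false ∷ w) , x) = inj₂ (w , x)
    from : Σ (Vec Bool n) (λ w → F (true ∷ w)) ⊎ Σ (Vec Bool n) (λ w → F (false ∷ w)) → Σ (Vec Bool (suc n)) F
    from (inj₁ (w , x)) = (true ∷ w) , x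
    from (inj₂ (w , x)) = (false ∷ w) , x

  Σ-masks↔Fin : ∀ n (F : Vec Bool n → Set) (g : Vec Bool n → ℕ) → (∀ w → F w ↔ Fin (g w)) →
                Σ (Vec Bool n) F ↔ Fin (sumMasks n g)
  Σ-masks↔Fin zero    F g F↔g = ↔-trans (Σ-Vec-[]↔ F) (F↔g [])
  Σ-masks↔Fin (suc n) F g F↔g =
    ↔-trans (Σ-Vec-∷↔ n F)
    (↔-trans (Σ-masks↔Fin n (λ w → F (true ∷ w)) (λ w → g (true ∷ w)) (λ w → F↔g (true ∷ w))
              ⊎-↔ Σ-masks↔Fin n (λ w → F (false ∷ w)) (λ w → g (false ∷ w)) (λ w → F↔g (false ∷ w)))
             (↔-sym Finₚ.+↔⊎))

  Fin-≡-↔ : ∀ {m n} → m ≡ n → Fin m ↔ Fin n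
  Fin-≡-↔ refl = ↔-refl

  -- structures on a labelled product are a pair of structures on complementary subsets of the labels
  labelledProduct : (ℕ → ℕ → ℕ) → (ℕ → ℕ → ℕ) → ℕ → ℕ → ℕ
  labelledProduct L R a b =
    sumMasks a (λ w → sumMasks b (λ v → L (#true w) (#true v) * R (a ∸ #true w) (b ∸ #true v)))

  -- a left branch is either absent (no labels at all) or a NAT under a left child carrying the largest left label
  leftBranchCount : (ℕ → ℕ → ℕ) → ℕ → ℕ → ℕ
  leftBranchCount M zero    zero    = 1
  leftBranchCount M zero    (suc _) = 0
  leftBranchCount M (suc i) j       = M i j

  rightBranchCount : (ℕ → ℕ → ℕ) → ℕ → ℕ → ℕ
  rightBranchCount M i       (suc j) = M i j
  rightBranchCount M zero    zero    = 1
  rightBranchCount M (suc _) zero    = 0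

  -- the first argument is fuel: the recursion is on a + b, and countNATs f a b is correct whenever a + b < f
  countNATs : ℕ → ℕ → ℕ → ℕ
  countNATs zero    = λ _ _ → 0
  countNATs (suc f) = labelledProduct (leftBranchCount (countNATs f)) (rightBranchCount (countNATs f))

  NATOn↔Fin : ∀ f X Y → Decreasing X → Decreasing Y → length X + length Y < f →
              NATOn X Y ↔ Fin (countNATs f (length X) (length Y))
  NATOn↔Fin (suc f) X Y X-decr Y-decr |X|+|Y|<1+f =
    ↔-trans (RootDecomposition.iso X Y (Decreasing⇒Distinct X X-decr) (Decreasing⇒Distinct Y Y-decr))
            (Σ-masks↔Fin (length X) _ _ λ w → Σ-masks↔Fin (length Y) _ _ λ v →
               ↔-trans (selectedLeft↔Fin w v ×-↔ selectedRight↔Fin w v) (↔-sym Finₚ.*↔×))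
    where
    leftBranch↔Fin : ∀ X₁ Y₁ → Decreasing X₁ → Decreasing Y₁ → length X₁ + length Y₁ < suc f →
                     LeftBranch X₁ Y₁ ↔ Fin (leftBranchCount (countNATs f) (length X₁) (length Y₁))
    leftBranch↔Fin []       []       _      _      _ = ↔-trans LeftBranch-[]-[] (↔-sym Finₚ.1↔⊤)
    leftBranch↔Fin []       (y ∷ Y₁) _      _      _ = ↔-trans (LeftBranch-[]-∷ y Y₁) (↔-sym Finₚ.0↔⊥)
    leftBranch↔Fin (h ∷ X₁) Y₁       hX₁-decr Y₁-decr (s≤s |X₁|+|Y₁|<f) =
      ↔-trans (LeftBranchCons.iso h X₁ Y₁ hX₁-decr) (NATOn↔Fin f X₁ Y₁ (proj₂ hX₁-decr) Y₁-decr |X₁|+|Y₁|<f)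
    rightBranch↔Fin : ∀ X₂ Y₂ → Decreasing X₂ → Decreasing Y₂ → length X₂ + length Y₂ < suc f →
                      RightBranch X₂ Y₂ ↔ Fin (rightBranchCount (countNATs f) (length X₂) (length Y₂))
    rightBranch↔Fin []       []       _      _      _ = ↔-trans RightBranch-[]-[] (↔-sym Finₚ.1↔⊤)
    rightBranch↔Fin (x ∷ X₂) []       _      _      _ = ↔-trans (RightBranch-∷-[] x X₂) (↔-sym Finₚ.0↔⊥)
    rightBranch↔Fin X₂       (h ∷ Y₂) X₂-decr hY₂-decr (s≤s |X₂|+1+|Y₂|≤f) =
      ↔-trans (RightBranchCons.iso h X₂ Y₂ hY₂-decr)
              (NATOn↔Fin f X₂ Y₂ X₂-decr (proj₂ hY₂-decr) (subst (_≤ f) (ℕₚ.+-suc (length X₂) (length Y₂)) |X₂|+1+|Y₂|≤f))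
    selected-< : ∀ {m n} → m ≤ length X → n ≤ length Y → m + n < suc f
    selected-< m≤|X| n≤|Y| = ℕₚ.≤-<-trans (ℕₚ.+-mono-≤ m≤|X| n≤|Y|) |X|+|Y|<1+f
    selectedLeft↔Fin : ∀ w v → LeftBranch (select X w) (select Y v) ↔ Fin (leftBranchCount (countNATs f) (#true w) (#true v))
    selectedLeft↔Fin w v =
      ↔-trans (leftBranch↔Fin (select X w) (select Y v) (Decreasing-select X w X-decr) (Decreasing-select Y v Y-decr)
                              (selected-< (length-select-≤ X w) (length-select-≤ Y v)))
              (Fin-≡-↔ (cong₂ (leftBranchCount (countNATs f)) (length-select X w) (length-select Y v)))
    selectedRight↔Fin : ∀ w v → RightBranch (select X (complement w)) (select Y (complement v)) ↔
                                Fin (rightBranchCount (countNATs f) (length X ∸ #true w) (length Y ∸ #true v))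
    selectedRight↔Fin w v =
      ↔-trans (rightBranch↔Fin (select X (complement w)) (select Y (complement v))
                               (Decreasing-select X (complement w) X-decr) (Decreasing-select Y (complement v) Y-decr)
                               (selected-< (length-select-≤ X (complement w)) (length-select-≤ Y (complement v))))
              (Fin-≡-↔ (cong₂ (rightBranchCount (countNATs f)) (length-select-complement X w) (length-select-complement Y v)))

module Labelling where

  open import Defs
  open LabelCounts
  open Branches
  open Enumeration
  open import Data.Bool using (Bool; true; false; _∧_; T)
  open import Data.Bool.Properties using (∧-comm; ∧-assoc; ∧-identityʳ)
  open import Data.Nat as ℕ using (ℕ; zero; suc; _+_; _≤_; s≤s; _≡ᵇ_)
  import Data.Nat.Properties as ℕₚ
  open import Data.List using (List; []; _∷_; _++_; length; upTo)
  import Data.List.Properties as Listₚ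
  open import Data.Fin using (Fin)
  open import Data.Product using (_×_; _,_; proj₁; proj₂)
  open import Data.Unit using (tt)
  open import Relation.Binary.PropositionalEquality
  open import Relation.Nullary using (yes; no)
  open import Function.Bundles using (_↔_; mk↔ₛ′)
  open import Function.Properties.Inverse using (↔-refl; ↔-trans)
  open import Data.Product.Function.NonDependent.Propositional using (_×-↔_)
  open import Data.Product.Function.Dependent.Propositional using (Σ-↔)

  labels : ℕ → List ℕ
  labels zero = []
  labels (suc a) = suc a ∷ labels a

  length-labels : ∀ a → length (labels a) ≡ a
  length-labels zero = refl
  length-labels (suc a) = cong suc (length-labels a)

  labels-bound : ∀ a y → 1 ≤ countᵇ y (labels a) → y ≤ a
  labels-bound zero y ()
  labels-bound (suc a) y le with y ℕₚ.≟ suc a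
  ... | yes refl = ℕₚ.≤-refl
  ... | no ne = ℕₚ.m≤n⇒m≤1+n (labels-bound a y (subst (1 ≤_) (countᵇ-there y (suc a) (labels a) ne) le))

  Decreasing-labels : ∀ a → Decreasing (labels a)
  Decreasing-labels zero = tt
  Decreasing-labels (suc a) = (λ y le → s≤s (labels-bound a y le)) , Decreasing-labels a

  allᵇ-++ : ∀ (p : ℕ → Bool) xs ys → allᵇ p (xs ++ ys) ≡ allᵇ p xs ∧ allᵇ p ys
  allᵇ-++ p [] ys = refl
  allᵇ-++ p (x ∷ xs) ys = trans (cong (p x ∧_) (allᵇ-++ p xs ys)) (sym (∧-assoc (p x) _ _))

  allᵇ-upTo : ∀ (p : ℕ → Bool) a → allᵇ (λ i → p (suc i)) (upTo a) ≡ allᵇ p (labels a)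
  allᵇ-upTo p zero = refl
  allᵇ-upTo p (suc a) = begin
      allᵇ (λ i → p (suc i)) (upTo (suc a))
    ≡⟨ cong (allᵇ (λ i → p (suc i))) (sym (Listₚ.upTo-∷ʳ a)) ⟩
      allᵇ (λ i → p (suc i)) (upTo a ++ (a ∷ []))
    ≡⟨ allᵇ-++ (λ i → p (suc i)) (upTo a) (a ∷ []) ⟩
      allᵇ (λ i → p (suc i)) (upTo a) ∧ (p (suc a) ∧ true)
    ≡⟨ cong₂ _∧_ (allᵇ-upTo p a) (∧-identityʳ (p (suc a))) ⟩
      allᵇ p (labels a) ∧ p (suc a)
    ≡⟨ ∧-comm (allᵇ p (labels a)) (p (suc a)) ⟩
      p (suc a) ∧ allᵇ p (labels a)
    ∎
    where open ≡-Reasoning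

  isLabelling≡isPermᵇ : ∀ a xs → isLabelling a xs ≡ isPermᵇ (labels a) xs
  isLabelling≡isPermᵇ a xs = cong₂ _∧_ (cong (length xs ≡ᵇ_) (sym (length-labels a))) (allᵇ-upTo (λ x → countᵇ x xs ≡ᵇ 1) a)

  T-∧-↔ : ∀ {x y} → T (x ∧ y) ↔ (T x × T y)
  T-∧-↔ {true}  = mk↔ₛ′ (tt ,_) proj₂ (λ _ → refl) (λ _ → refl)
  T-∧-↔ {false} = mk↔ₛ′ (λ ()) proj₁ (λ { (() , _) }) (λ ())

  T-≡-↔ : ∀ {x y} → x ≡ y → T x ↔ T y
  T-≡-↔ refl = ↔-refl

  T-isNAT↔ValidTree : ∀ a b t → T (isNAT a b t) ↔ ValidTree (labels a) (labels b) t
  T-isNAT↔ValidTree a b t =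
    ↔-trans (T-∧-↔ {isLabelling a (leftLabels t)}) (T-≡-↔ (isLabelling≡isPermᵇ a (leftLabels t)) ×-↔
    ↔-trans (T-∧-↔ {isLabelling b (rightLabels t)}) (T-≡-↔ (isLabelling≡isPermᵇ b (rightLabels t)) ×-↔
    T-∧-↔ {leftDecr t}))

  N : ℕ → ℕ → ℕ
  N a b = countNATs (suc (a + b)) a b

  NAT↔Fin : ∀ a b → NAT a b ↔ Fin (N a b)
  NAT↔Fin a b =
    ↔-trans (Σ-↔ ↔-refl (λ {t} → T-isNAT↔ValidTree a b t))
    (↔-trans (NATOn↔Fin (suc (a + b)) (labels a) (labels b) (Decreasing-labels a) (Decreasing-labels b)
                        (s≤s (ℕₚ.≤-reflexive (cong₂ _+_ (length-labels a) (length-labels b)))))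
             (Fin-≡-↔ (cong₂ (countNATs (suc (a + b))) (length-labels a) (length-labels b))))

module Binomial where

  open import Defs
  open FiniteSum
  open NatCast
  open LabelCounts using (#true)
  open Enumeration using (sumMasks)
  open import Data.Nat as ℕ using (ℕ; zero; suc; _∸_; _≤_; _!)
  import Data.Nat.Properties as ℕₚ
  open import Data.Nat.Properties using (_!*_!≢0)
  open import Data.Nat.Combinatorics using (_C_; nCk≡n!/k![n-k]!; k>n⇒nCk≡0; nCk+nC[k+1]≡[n+1]C[k+1]; k![n∸k]!∣n!)
  open import Data.Nat.DivMod using (m/n*n≡m)
  open import Data.Rational using (ℚ; _+_; _*_)
  open import Data.Rational.Properties
  open import Relation.Binary.PropositionalEquality

  nCk*k!*[n∸k]!≡n! : ∀ {n k} → k ≤ n → (n C k) ℕ.* (k ! ℕ.* (n ∸ k) !) ≡ n !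
  nCk*k!*[n∸k]!≡n! {n} {k} k≤n =
    trans (cong (ℕ._* (k ! ℕ.* (n ∸ k) !)) (nCk≡n!/k![n-k]! k≤n)) (m/n*n≡m (k![n∸k]!∣n! k≤n))
    where instance _ = k !* (n ∸ k) !≢0

  -- Pascal's rule, read off the first entry of the mask
  sumMasks-binomial : ∀ n (g : ℕ → ℕ) →
    fromNat (sumMasks n (λ w → g (#true w))) ≡ sumTo n (λ i → fromNat (n C i) * fromNat (g i))
  sumMasks-binomial zero    g = sym (*-identityˡ (fromNat (g 0)))
  sumMasks-binomial (suc n) g = begin
    fromNat (sumMasks n (λ w → g (suc (#true w))) ℕ.+ sumMasks n (λ w → g (#true w)))
      ≡⟨ fromNat-+ (sumMasks n (λ w → g (suc (#true w)))) (sumMasks n (λ w → g (#true w))) ⟩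
    fromNat (sumMasks n (λ w → g (suc (#true w)))) + fromNat (sumMasks n (λ w → g (#true w)))
      ≡⟨ cong₂ _+_ (sumMasks-binomial n (λ i → g (suc i))) (sumMasks-binomial n g) ⟩
    sumTo n (λ i → c n i * G (suc i)) + sumTo n (λ i → c n i * G i)
      ≡⟨ +-comm (sumTo n (λ i → c n i * G (suc i))) _ ⟩
    sumTo n (λ i → c n i * G i) + sumTo n (λ i → c n i * G (suc i))
      ≡⟨ cong (_+ sumTo n (λ i → c n i * G (suc i))) drop-top ⟩
    sumTo (suc n) (λ i → c n i * G i) + sumTo n (λ i → c n i * G (suc i))
      ≡⟨ cong (_+ sumTo n (λ i → c n i * G (suc i))) (sumTo-suc n (λ i → c n i * G i)) ⟩
    (c n 0 * G 0 + sumTo n (λ i → c n (suc i) * G (suc i))) + sumTo n (λ i → c n i * G (suc i))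
      ≡⟨ +-assoc (c n 0 * G 0) _ _ ⟩
    c n 0 * G 0 + (sumTo n (λ i → c n (suc i) * G (suc i)) + sumTo n (λ i → c n i * G (suc i)))
      ≡⟨ cong (c n 0 * G 0 +_) (trans (sym (sumTo-+ n _ _)) (sumTo-cong n (λ i _ → pascal i))) ⟩
    c (suc n) 0 * G 0 + sumTo n (λ i → c (suc n) (suc i) * G (suc i))
      ≡⟨ sumTo-suc n (λ i → c (suc n) i * G i) ⟨
    sumTo (suc n) (λ i → c (suc n) i * G i)
      ∎
    where
    open ≡-Reasoning
    c : ℕ → ℕ → ℚ
    c n i = fromNat (n C i)
    G : ℕ → ℚ
    G i = fromNat (g i)
    drop-top : sumTo n (λ i → c n i * G i) ≡ sumTo (suc n) (λ i → c n i * G i)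
    drop-top = sym (sumTo-extend n (suc n) _ (λ k n<k → trans (cong (λ m → fromNat m * G k) (k>n⇒nCk≡0 n<k)) (*-zeroˡ (G k))) (ℕₚ.n≤1+n n))
    pascal : ∀ i → c n (suc i) * G (suc i) + c n i * G (suc i) ≡ c (suc n) (suc i) * G (suc i)
    pascal i = begin
      c n (suc i) * G (suc i) + c n i * G (suc i)   ≡⟨ *-distribʳ-+ (G (suc i)) (c n (suc i)) (c n i) ⟨
      (c n (suc i) + c n i) * G (suc i)             ≡⟨ cong (_* G (suc i)) (trans (+-comm (c n (suc i)) (c n i)) (sym (fromNat-+ (n C i) (n C suc i)))) ⟩
      fromNat (n C i ℕ.+ n C suc i) * G (suc i)     ≡⟨ cong (λ m → fromNat m * G (suc i)) (nCk+nC[k+1]≡[n+1]C[k+1] n i) ⟩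
      c (suc n) (suc i) * G (suc i)                 ∎

module ExponentialGF where

  open import Defs
  open FiniteSum
  open NatCast
  open PowerSeries
  open Derivation
  open LabelCounts using (#true)
  open Enumeration using (sumMasks; labelledProduct; leftBranchCount; rightBranchCount)
  open Binomial
  open import Data.Nat as ℕ using (ℕ; zero; suc; _∸_; _≤_; _<_; s≤s; _!)
  import Data.Nat.Properties as ℕₚ
  open import Data.Nat.Combinatorics using (_C_)
  open import Data.Rational using (1ℚ; _*_)
  open import Data.Rational.Properties
  open import Data.Rational.Solver using (module +-*-Solver)
  open import Relation.Binary.PropositionalEquality

  record EGFBelow (n : ℕ) (M : ℕ → ℕ → ℕ) (F : FPS) : Set where
    constructor egfBelow
    field coeff : ∀ a b → a ℕ.+ b < n → fromNat (M a b) ≡ fromNat (a ! ℕ.* b !) * F a b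
  open EGFBelow public

  EGFBelow-≈ : ∀ {n M F G} → F ≈F G → EGFBelow n M F → EGFBelow n M G
  EGFBelow-≈ F≈G M-EGF = egfBelow λ a b a+b<n → trans (coeff M-EGF a b a+b<n) (cong (fromNat (a ! ℕ.* b !) *_) (F≈G a b))

  private
    x*[y*z]≡y*x*z : ∀ x y z → x * (y * z) ≡ y * x * z
    x*[y*z]≡y*x*z x y z = trans (sym (*-assoc x y z)) (cong (_* z) (*-comm x y))

  leftBranchCount-EGF : ∀ {n M G E} → dx E ≈F G → (∀ j → E 0 j ≡ oneF 0 j) →
                        EGFBelow n M G → EGFBelow (suc n) (leftBranchCount M) E
  leftBranchCount-EGF {n} {M} {G} {E} dxE≈G E-x⁰ M-EGF = egfBelow coeffs
    where
    coeffs : ∀ a b → a ℕ.+ b < suc n → fromNat (leftBranchCount M a b) ≡ fromNat (a ! ℕ.* b !) * E a b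
    coeffs zero zero _ =
      sym (trans (cong (1ℚ *_) (E-x⁰ 0)) (*-identityˡ 1ℚ))
    coeffs zero (suc j) _ =
      sym (trans (cong (fromNat (0 ! ℕ.* suc j !) *_) (E-x⁰ (suc j))) (*-zeroʳ (fromNat (0 ! ℕ.* suc j !))))
    coeffs (suc i) j (s≤s i+j<n) = begin
      fromNat (M i j)                                          ≡⟨ coeff M-EGF i j i+j<n ⟩
      fromNat (i ! ℕ.* j !) * G i j                            ≡⟨ cong (fromNat (i ! ℕ.* j !) *_) (dxE≈G i j) ⟨
      fromNat (i ! ℕ.* j !) * (fromNat (suc i) * E (suc i) j)  ≡⟨ x*[y*z]≡y*x*z (fromNat (i ! ℕ.* j !)) (fromNat (suc i)) (E (suc i) j) ⟩
      fromNat (suc i) * fromNat (i ! ℕ.* j !) * E (suc i) j    ≡⟨ cong (_* E (suc i) j) (fromNat-* (suc i) (i ! ℕ.* j !)) ⟨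
      fromNat (suc i ℕ.* (i ! ℕ.* j !)) * E (suc i) j          ≡⟨ cong (λ m → fromNat m * E (suc i) j) (ℕₚ.*-assoc (suc i) (i !) (j !)) ⟨
      fromNat (suc i ! ℕ.* j !) * E (suc i) j                  ∎
      where open ≡-Reasoning

  rightBranchCount-EGF : ∀ {n M G E} → dy E ≈F G → (∀ i → E i 0 ≡ oneF i 0) →
                         EGFBelow n M G → EGFBelow (suc n) (rightBranchCount M) E
  rightBranchCount-EGF {n} {M} {G} {E} dyE≈G E-y⁰ M-EGF = egfBelow coeffs
    where
    open ≡-Reasoning
    [1+j]*[i!*j!]≡i!*[1+j]! : ∀ i j → suc j ℕ.* (i ! ℕ.* j !) ≡ i ! ℕ.* suc j !
    [1+j]*[i!*j!]≡i!*[1+j]! i j = trans (sym (ℕₚ.*-assoc (suc j) (i !) (j !)))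
      (trans (cong (ℕ._* j !) (ℕₚ.*-comm (suc j) (i !))) (ℕₚ.*-assoc (i !) (suc j) (j !)))
    coeffs : ∀ a b → a ℕ.+ b < suc n → fromNat (rightBranchCount M a b) ≡ fromNat (a ! ℕ.* b !) * E a b
    coeffs i (suc j) (s≤s i+[1+j]<n) = begin
      fromNat (M i j)                                          ≡⟨ coeff M-EGF i j (subst (_≤ n) (ℕₚ.+-suc i j) i+[1+j]<n) ⟩
      fromNat (i ! ℕ.* j !) * G i j                            ≡⟨ cong (fromNat (i ! ℕ.* j !) *_) (dyE≈G i j) ⟨
      fromNat (i ! ℕ.* j !) * (fromNat (suc j) * E i (suc j))  ≡⟨ x*[y*z]≡y*x*z (fromNat (i ! ℕ.* j !)) (fromNat (suc j)) (E i (suc j)) ⟩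
      fromNat (suc j) * fromNat (i ! ℕ.* j !) * E i (suc j)    ≡⟨ cong (_* E i (suc j)) (fromNat-* (suc j) (i ! ℕ.* j !)) ⟨
      fromNat (suc j ℕ.* (i ! ℕ.* j !)) * E i (suc j)          ≡⟨ cong (λ m → fromNat m * E i (suc j)) ([1+j]*[i!*j!]≡i!*[1+j]! i j) ⟩
      fromNat (i ! ℕ.* suc j !) * E i (suc j)                  ∎
    coeffs zero zero _ =
      sym (trans (cong (1ℚ *_) (E-y⁰ 0)) (*-identityˡ 1ℚ))
    coeffs (suc i) zero _ =
      sym (trans (cong (fromNat (suc i ! ℕ.* 0 !) *_) (E-y⁰ (suc i))) (*-zeroʳ (fromNat (suc i ! ℕ.* 0 !))))

  fromNat-nCk*k!*[n∸k]! : ∀ {n k} → k ≤ n → fromNat (n C k) * (fromNat (k !) * fromNat ((n ∸ k) !)) ≡ fromNat (n !)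
  fromNat-nCk*k!*[n∸k]! {n} {k} k≤n = begin
    fromNat (n C k) * (fromNat (k !) * fromNat ((n ∸ k) !))   ≡⟨ cong (fromNat (n C k) *_) (fromNat-* (k !) ((n ∸ k) !)) ⟨
    fromNat (n C k) * fromNat (k ! ℕ.* (n ∸ k) !)             ≡⟨ fromNat-* (n C k) (k ! ℕ.* (n ∸ k) !) ⟨
    fromNat ((n C k) ℕ.* (k ! ℕ.* (n ∸ k) !))                 ≡⟨ cong fromNat (nCk*k!*[n∸k]!≡n! k≤n) ⟩
    fromNat (n !)                                             ∎
    where open ≡-Reasoning

  labelledProduct-EGF : ∀ {n L R E₁ E₂} → EGFBelow n L E₁ → EGFBelow n R E₂ →
                        EGFBelow n (labelledProduct L R) (E₁ ⊛ E₂)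
  labelledProduct-EGF {n} {L} {R} {E₁} {E₂} L-EGF R-EGF = egfBelow coeffs
    where
    coeffs : ∀ a b → a ℕ.+ b < n → fromNat (labelledProduct L R a b) ≡ fromNat (a ! ℕ.* b !) * (E₁ ⊛ E₂) a b
    coeffs a b a+b<n = begin
      fromNat (labelledProduct L R a b)
        ≡⟨ sumMasks-binomial a (λ i → sumMasks b (λ v → T i (#true v))) ⟩
      sumTo a (λ i → fromNat (a C i) * fromNat (sumMasks b (λ v → T i (#true v))))
        ≡⟨ sumTo-cong a (λ i _ → cong (fromNat (a C i) *_) (sumMasks-binomial b (T i))) ⟩
      sumTo a (λ i → fromNat (a C i) * sumTo b (λ j → fromNat (b C j) * fromNat (T i j)))
        ≡⟨ sumTo-cong a (λ i i≤a → trans (*-sumToˡ b (fromNat (a C i)) _) (sumTo-cong b (λ j j≤b → term i≤a j≤b))) ⟩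
      sumTo a (λ i → sumTo b (λ j → a!b! * (E₁ i j * E₂ (a ∸ i) (b ∸ j))))
        ≡⟨ trans (*-sumToˡ a a!b! _) (sumTo-cong a (λ i _ → *-sumToˡ b a!b! _)) ⟨
      a!b! * (E₁ ⊛ E₂) a b
        ∎
      where
      open ≡-Reasoning
      a!b! = fromNat (a ! ℕ.* b !)
      T : ℕ → ℕ → ℕ
      T i j = L i j ℕ.* R (a ∸ i) (b ∸ j)
      term : ∀ {i j} → i ≤ a → j ≤ b →
             fromNat (a C i) * (fromNat (b C j) * fromNat (T i j)) ≡ a!b! * (E₁ i j * E₂ (a ∸ i) (b ∸ j))
      term {i} {j} i≤a j≤b = begin
        fromNat (a C i) * (fromNat (b C j) * fromNat (T i j))
          ≡⟨ cong (λ t → fromNat (a C i) * (fromNat (b C j) * t))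
               (trans (fromNat-* (L i j) (R (a ∸ i) (b ∸ j))) (cong₂ _*_ L-coeff R-coeff)) ⟩
        fromNat (a C i) * (fromNat (b C j) * ((fromNat (i !) * fromNat (j !) * E₁ i j)
                                            * (fromNat ((a ∸ i) !) * fromNat ((b ∸ j) !) * E₂ (a ∸ i) (b ∸ j))))
          ≡⟨ solve 8 (λ ca cb fi fj fa fb e₁ e₂ →
               ca :* (cb :* ((fi :* fj :* e₁) :* (fa :* fb :* e₂)))
               := (ca :* (fi :* fa)) :* (cb :* (fj :* fb)) :* (e₁ :* e₂)) refl
               (fromNat (a C i)) (fromNat (b C j)) (fromNat (i !)) (fromNat (j !))
               (fromNat ((a ∸ i) !)) (fromNat ((b ∸ j) !)) (E₁ i j) (E₂ (a ∸ i) (b ∸ j)) ⟩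
        fromNat (a C i) * (fromNat (i !) * fromNat ((a ∸ i) !)) * (fromNat (b C j) * (fromNat (j !) * fromNat ((b ∸ j) !)))
          * (E₁ i j * E₂ (a ∸ i) (b ∸ j))
          ≡⟨ cong (_* (E₁ i j * E₂ (a ∸ i) (b ∸ j))) (cong₂ _*_ (fromNat-nCk*k!*[n∸k]! i≤a) (fromNat-nCk*k!*[n∸k]! j≤b)) ⟩
        fromNat (a !) * fromNat (b !) * (E₁ i j * E₂ (a ∸ i) (b ∸ j))
          ≡⟨ cong (_* (E₁ i j * E₂ (a ∸ i) (b ∸ j))) (fromNat-* (a !) (b !)) ⟨
        a!b! * (E₁ i j * E₂ (a ∸ i) (b ∸ j))
          ∎
        where
        open +-*-Solver
        L-coeff : fromNat (L i j) ≡ fromNat (i !) * fromNat (j !) * E₁ i j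
        L-coeff = trans (coeff L-EGF i j (ℕₚ.≤-<-trans (ℕₚ.+-mono-≤ i≤a j≤b) a+b<n)) (cong (_* E₁ i j) (fromNat-* (i !) (j !)))
        R-coeff : fromNat (R (a ∸ i) (b ∸ j)) ≡ fromNat ((a ∸ i) !) * fromNat ((b ∸ j) !) * E₂ (a ∸ i) (b ∸ j)
        R-coeff = trans (coeff R-EGF (a ∸ i) (b ∸ j) (ℕₚ.≤-<-trans (ℕₚ.+-mono-≤ (ℕₚ.m∸n≤m a i) (ℕₚ.m∸n≤m b j)) a+b<n))
                        (cong (_* E₂ (a ∸ i) (b ∸ j)) (fromNat-* ((a ∸ i) !) ((b ∸ j) !)))

open import Data.Nat as ℕ using (zero; suc; _!)
import Data.Nat.Properties as ℕₚ
open import Data.Nat.Properties using (_!*_!≢0)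
open import Data.Rational using (_*_)
open import Data.Rational.Solver using (module +-*-Solver)
open import Relation.Binary.PropositionalEquality using (refl; sym; cong; cong₂; module ≡-Reasoning)
open NatCast
open PowerSeries
open SeriesSolver using (≈F-sym)
open Derivation
open ClosedForm
open Enumeration using (countNATs)
open Labelling using (N; NAT↔Fin)
open ExponentialGF

countNATs-EGF : ∀ f → EGFBelow f (countNATs f) rhsG
countNATs-EGF zero    = egfBelow λ _ _ ()
countNATs-EGF (suc f) =
  EGFBelow-≈ (≈F-sym rhsG-factor)
    (labelledProduct-EGF (leftBranchCount-EGF {E = expX ⊛ Q} dx-expX⊛Q expX⊛Q-x⁰ (countNATs-EGF f))
                         (rightBranchCount-EGF {E = expY ⊛ Q} dy-expY⊛Q expY⊛Q-y⁰ (countNATs-EGF f)))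

N-EGF : ∀ a b → fromNat (N a b) ≡ fromNat (a ! ℕ.* b !) * rhsG a b
N-EGF a b = coeff (countNATs-EGF (suc (a ℕ.+ b))) a b ℕₚ.≤-refl

Gser-N : ∀ a b → Gser N a b ≡ rhsG a b
Gser-N a b = /-unique (N a b) (a ! ℕ.* b !) (rhsG a b) (sym (N-EGF a b))
  where instance _ = a !* b !≢0

Hser-N : ∀ a b → Hser N a b ≡ rhsH a b
Hser-N zero    b       = sym (substF-x⁰ negLogOneMinus refl b)
Hser-N (suc a) zero    = sym (substF-y⁰ negLogOneMinus refl (suc a))
Hser-N (suc a) (suc b) = /-unique (N a b) (suc a ! ℕ.* suc b !) (rhsH (suc a) (suc b)) (begin
  fromNat (suc a ! ℕ.* suc b !) * H                                  ≡⟨ cong (_* H) (fromNat-* (suc a !) (suc b !)) ⟩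
  fromNat (suc a !) * fromNat (suc b !) * H                          ≡⟨ cong₂ (λ x y → x * y * H) (fromNat-* (suc a) (a !)) (fromNat-* (suc b) (b !)) ⟩
  fromNat (suc a) * fromNat (a !) * (fromNat (suc b) * fromNat (b !)) * H
    ≡⟨ solve 5 (λ x a! y b! h → x :* a! :* (y :* b!) :* h := a! :* b! :* (y :* (x :* h))) refl
         (fromNat (suc a)) (fromNat (a !)) (fromNat (suc b)) (fromNat (b !)) H ⟩
  fromNat (a !) * fromNat (b !) * dy (dx rhsH) a b                   ≡⟨ cong₂ _*_ (sym (fromNat-* (a !) (b !))) (dy-dx-rhsH a b) ⟩
  fromNat (a ! ℕ.* b !) * rhsG a b                                   ≡⟨ N-EGF a b ⟨
  fromNat (N a b)                                                    ∎)
  where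
  open ≡-Reasoning
  open +-*-Solver
  H = rhsH (suc a) (suc b)
  instance _ = suc a !* suc b !≢0

mainTheorem2 : Σ (ℕ → ℕ → ℕ) (λ N →
                 ((a b : ℕ) → NAT a b ↔ Fin (N a b))
                 × ((a b : ℕ) → Gser N a b ≡ rhsG a b)
                 × ((a b : ℕ) → Hser N a b ≡ rhsH a b))
mainTheorem2 = N , NAT↔Fin , Gser-N , Hser-N
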